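{- If $n\ge 3$, then $$\mathrm{mob}(C_n\,\square\, K_2)=\begin{cases}3, & n=3,\\ 2, & n=4,\\ 4, & n\ge 5.\end{cases}$$
   Context: $C_n$ is the cycle on $n$ vertices; $\square$ is the Cartesian product (so $C_n\,\square\,K_2$ is the prism over $C_n$). A set $S\subseteq V(G)$ is a general position set if no three vertices of $S$ lie on a common shortest path. Robots are placed one per vertex of a general position set $S$; a move $u\to v$ along an edge $uv$ with $u\in S$ is legal if $v\notin S$ and $(S\setminus\{u\})\cup\{v\}$ is a general position set. $S$ is a mobile general position set if some sequence of legal moves starting from $S$ visits every vertex at least once; $\mathrm{mob}(G)$ is the maximum size of a mobile general position set. -}

module Defs where

open import Data.Nat using (ℕ; zero; suc; _+_; _≤_; _<_)
open import Data.Fin using (Fin; toℕ)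
open import Data.Product using (Σ; ∃; ∃-syntax; _×_; _,_)
open import Data.Sum using (_⊎_)
open import Data.List using (List; []; _∷_; length)
open import Data.List.Membership.Propositional using (_∈_; _∉_)
open import Data.List.Relation.Unary.Unique.Propositional using (Unique)
open import Relation.Binary.PropositionalEquality using (_≡_; _≢_)
open import Relation.Nullary using (¬_)

record Graph : Set₁ where
  field
    V : Set
    E : V → V → Set
open Graph public

CycleE : (n : ℕ) → Fin n → Fin n → Set
CycleE n i j = suc (toℕ i) ≡ toℕ j ⊎ suc (toℕ j) ≡ toℕ i
             ⊎ (toℕ i ≡ 0 × suc (toℕ j) ≡ n) ⊎ (toℕ j ≡ 0 × suc (toℕ i) ≡ n)

Cycle : ℕ → Graph
Cycle n = record { V = Fin n ; E = CycleE n }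

K₂ : Graph
K₂ = record { V = Fin 2 ; E = λ a b → a ≢ b }

_□_ : Graph → Graph → Graph
G □ H = record
  { V = V G × V H
  ; E = λ { (g , h) (g' , h') → (g ≡ g' × E H h h') ⊎ (E G g g' × h ≡ h') } }

module _ (G : Graph) where

  data Walk : V G → V G → Set where
    [_]  : (a : V G) → Walk a a
    _∷⟨_⟩_ : (a : V G) {b c : V G} → E G a b → Walk b c → Walk a c

  walkLength : {a b : V G} → Walk a b → ℕ
  walkLength [ a ] = 0
  walkLength (a ∷⟨ _ ⟩ w) = suc (walkLength w)

  data OnWalk (x : V G) : {a b : V G} → Walk a b → Set where
    here-end : OnWalk x [ x ]
    here : {b c : V G} (e : E G x b) (w : Walk b c) → OnWalk x (x ∷⟨ e ⟩ w)
    there : {a b c : V G} (e : E G a b) {w : Walk b c} → OnWalk x w → OnWalk x (a ∷⟨ e ⟩ w)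

  IsShortest : {a b : V G} → Walk a b → Set
  IsShortest {a} {b} w = (w' : Walk a b) → walkLength w ≤ walkLength w'

  GeneralPosition : List (V G) → Set
  GeneralPosition S =
    Unique S ×
    ((x y z : V G) → x ∈ S → y ∈ S → z ∈ S → x ≢ y → y ≢ z → x ≢ z →
      ¬ (Σ (V G) λ a → Σ (V G) λ b → Σ (Walk a b) λ w →
           IsShortest w × OnWalk x w × OnWalk y w × OnWalk z w))

  LegalMove : List (V G) → List (V G) → Set
  LegalMove S S' = Σ (V G) λ u → Σ (V G) λ v →
    u ∈ S × E G u v × v ∉ S × Unique S' ×
    ((w : V G) → (w ∈ S' → (w ∈ S × w ≢ u) ⊎ w ≡ v) ×
                 ((w ∈ S × w ≢ u) ⊎ w ≡ v → w ∈ S')) ×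
    GeneralPosition S'

  data MoveSeq : List (V G) → List (List (V G)) → Set where
    stop : (S : List (V G)) → MoveSeq S (S ∷ [])
    move : {S S' : List (V G)} {tr : List (List (V G))} →
           LegalMove S S' → MoveSeq S' tr → MoveSeq S (S ∷ tr)

  Mobile : List (V G) → Set
  Mobile S = GeneralPosition S ×
    Σ (List (List (V G))) λ tr → MoveSeq S tr ×
      ((x : V G) → Σ (List (V G)) λ T → T ∈ tr × x ∈ T)

  MobEq : ℕ → Set
  MobEq k = (Σ (List (V G)) λ S → Mobile S × length S ≡ k) ×
            ((S : List (V G)) → Mobile S → length S ≤ k)

{-# OPTIONS --safe #-}
module Submission where

-- Three vertices lie on a common shortest path exactly when one of them is between the
-- other two, d x y + d y z = d x z.  In Cₙ □ K₂ the distance is the cycle distance plus the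
-- layer distance, so betweenness splits into betweenness on the cycle and on K₂; and three
-- points of the cycle cut it into three arcs, a point being between the other two exactly
-- when the opposite arc is at least half of the cycle.
--
-- Upper bound: three vertices of one layer together with any fourth vertex always contain
-- a collinear triple, because one of the two arcs joining the fourth vertex to a suitable
-- vertex of the layer is at least half of the cycle; so by pigeonhole a general position set
-- has at most four vertices.  Lower bound for n ≥ 5: four vertices alternating between the layers, with
-- all four arcs between consecutive ones shorter than n / 2, are in general position, and a
-- round of four one-step moves carries such a set onto its rotation by one step; repeating
-- the round moves every robot around its whole layer.  For n = 3 and n = 4 the bounds are
-- checked exhaustively; in C₄ □ K₂ a general position set of three robots cannot move at all.

open import Defs
open import Data.Empty using (⊥; ⊥-elim)
open import Data.Fin using (Fin; zero; suc; toℕ; fromℕ<)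
open import Data.Fin.Properties using (toℕ-fromℕ<; toℕ-injective; toℕ<n; all?)
  renaming (_≟_ to _≟ᶠ_; <-cmp to <-cmpᶠ)
open import Data.List using (List; []; _∷_; _++_; length; map; filter)
open import Data.List.Membership.Propositional using (_∈_; _∉_)
open import Data.List.Membership.Propositional.Properties
  using (∈-map⁺; ∈-map⁻; ∈-++⁺ˡ; ∈-++⁺ʳ; ∈-++⁻; ∈-filter⁻)
open import Data.List.Relation.Unary.All as All using ([]; _∷_)
open import Data.List.Relation.Unary.AllPairs using (AllPairs; []; _∷_)
open import Data.List.Relation.Unary.Any using (here; there)
open import Data.List.Relation.Unary.Unique.Propositional using (Unique)
import Data.List.Relation.Unary.Unique.Propositional.Properties as Unique
open import Data.Nat
  using (ℕ; zero; suc; _+_; _∸_; _⊓_; ∣_-_∣; _≤_; _<_; _≟_; _≤?_; _<?_; z≤n; s≤s; z<s; s<s; NonZero)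
open import Data.Nat.DivMod
  using (_%_; _mod_; m%n<n; m<n⇒m%n≡m; n%n≡0; m%n%n≡m%n; %-distribˡ-+; [m+n]%n≡m%n)
open import Data.Nat.Properties
open import Algebra.Properties.CommutativeSemigroup +-commutativeSemigroup
  using (interchange; x∙yz≈y∙xz; xy∙z≈xz∙y; xy∙z≈zy∙x)
open import Data.Product using (Σ; _×_; _,_; proj₁; proj₂)
open import Data.Product.Properties using (≡-dec)
open import Data.Sum using (_⊎_; inj₁; inj₂; [_,_]′)
open import Function using (_∘_; id)
open import Function.Bundles using (_⇔_; mk⇔; Equivalence)
open import Relation.Binary.Definitions using (DecidableEquality; Trichotomous; tri<; tri≈; tri>)
open import Relation.Binary.PropositionalEquality
  using (_≡_; _≢_; refl; sym; trans; cong; cong₂; subst; subst₂; module ≡-Reasoning)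
open import Relation.Nullary using (¬_; Dec; yes; no; contradiction)
open import Relation.Nullary.Decidable
  using (True; False; toWitness; toWitnessFalse; from-yes; map′; ¬?; _×-dec_; _⊎-dec_; _→-dec_)
open import Relation.Unary using (Decidable)
open import Relation.Unary.Properties using (∁?)

open Equivalence using (to; from)

_^_ : {A : Set} → (A → A) → ℕ → A → A
(f ^ zero)  = id
(f ^ suc k) = f ∘ (f ^ k)

allPairs-lookup : {A : Set} {R : A → A → Set} {xs : List A} {y z : A} →
                  AllPairs R xs → y ∈ xs → z ∈ xs → y ≢ z → R y z ⊎ R z y
allPairs-lookup (r ∷ rs) (here refl) (here refl) y≢z = ⊥-elim (y≢z refl)
allPairs-lookup (r ∷ rs) (here refl) (there z∈)  _   = inj₁ (All.lookup r z∈)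
allPairs-lookup (r ∷ rs) (there y∈)  (here refl) _   = inj₂ (All.lookup r y∈)
allPairs-lookup (r ∷ rs) (there y∈)  (there z∈)  y≢z = allPairs-lookup rs y∈ z∈ y≢z

unique-middle : {A : Set} (pre : List A) {x : A} {post : List A} {w : A} →
                Unique (pre ++ x ∷ post) → w ∈ pre ⊎ w ∈ post → w ≢ x
unique-middle []        (x≢ ∷ _) (inj₂ w∈post)        w≡x = All.lookup x≢ w∈post (sym w≡x)
unique-middle (y ∷ pre) (y≢ ∷ _) (inj₁ (here refl))   = All.lookup y≢ (∈-++⁺ʳ pre (here refl))
unique-middle (y ∷ pre) (_ ∷ u)  (inj₁ (there w∈pre)) = unique-middle pre u (inj₁ w∈pre)
unique-middle (y ∷ pre) (_ ∷ u)  (inj₂ w∈post)        = unique-middle pre u (inj₂ w∈post)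

length-filter+∁ : {A : Set} {P : A → Set} (P? : Decidable P) (xs : List A) →
                  length (filter P? xs) + length (filter (∁? P?) xs) ≡ length xs
length-filter+∁ P? []       = refl
length-filter+∁ P? (x ∷ xs) with P? x
... | yes _ = cong suc (length-filter+∁ P? xs)
... | no  _ = trans (+-suc _ _) (cong suc (length-filter+∁ P? xs))

two-others : {A : Set} → DecidableEquality A → ∀ {xs} (u : A) → Unique xs → 3 ≤ length xs →
             Σ A λ w₁ → Σ A λ w₂ → w₁ ∈ xs × w₂ ∈ xs × w₁ ≢ w₂ × u ≢ w₁ × u ≢ w₂
two-others _≟_ {[]}         _ _ ()
two-others _≟_ {_ ∷ []}     _ _ (s≤s ())
two-others _≟_ {_ ∷ _ ∷ []} _ _ (s≤s (s≤s ()))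
two-others _≟_ {x ∷ y ∷ z ∷ _} u ((x≢y ∷ x≢z ∷ _) ∷ (y≢z ∷ _) ∷ _) _ with u ≟ x | u ≟ y
... | yes refl | _        = y , z , there (here refl) , there (there (here refl)) , y≢z , x≢y , x≢z
... | no _     | yes refl = x , z , here refl , there (there (here refl)) , x≢z , x≢y ∘ sym , y≢z
... | no u≢x   | no u≢y   = x , y , here refl , there (here refl) , x≢y , u≢x , u≢y

wlog-sorted₃ : {A : Set} {_<_ : A → A → Set} → Trichotomous _≡_ _<_ → (P : A → A → A → Set) →
               (∀ {x y z} → P x y z → P y x z) → (∀ {x y z} → P x y z → P x z y) →
               (∀ {x y z} → x < y → y < z → P x y z) →
               ∀ {x y z} → x ≢ y → y ≢ z → x ≢ z → P x y z
wlog-sorted₃ compare P swap₁₂ swap₂₃ sorted {x} {y} {z} x≢y y≢z x≢z with compare x y | compare y z | compare x z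
... | tri≈ _ x≡y _ | _            | _            = ⊥-elim (x≢y x≡y)
... | _            | tri≈ _ y≡z _ | _            = ⊥-elim (y≢z y≡z)
... | _            | _            | tri≈ _ x≡z _ = ⊥-elim (x≢z x≡z)
... | tri< x<y _ _ | tri< y<z _ _ | _            = sorted x<y y<z
... | tri< x<y _ _ | tri> _ _ z<y | tri< x<z _ _ = swap₂₃ (sorted x<z z<y)
... | tri< x<y _ _ | tri> _ _ z<y | tri> _ _ z<x = swap₂₃ (swap₁₂ (sorted z<x x<y))
... | tri> _ _ y<x | tri< y<z _ _ | tri< x<z _ _ = swap₁₂ (sorted y<x x<z)
... | tri> _ _ y<x | tri< y<z _ _ | tri> _ _ z<x = swap₁₂ (swap₂₃ (sorted y<z z<x))
... | tri> _ _ y<x | tri> _ _ z<y | _            = swap₁₂ (swap₂₃ (swap₁₂ (sorted z<y y<x)))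

module Walks (G : Graph) where

  ‖_‖ : ∀ {a b} → Walk G a b → ℕ
  ‖_‖ = walkLength G

  infixr 5 _++ʷ_

  _++ʷ_ : ∀ {a b c} → Walk G a b → Walk G b c → Walk G a c
  [ _ ]        ++ʷ w′ = w′
  (a ∷⟨ e ⟩ w) ++ʷ w′ = a ∷⟨ e ⟩ (w ++ʷ w′)

  ‖++ʷ‖ : ∀ {a b c} (w : Walk G a b) (w′ : Walk G b c) → ‖ w ++ʷ w′ ‖ ≡ ‖ w ‖ + ‖ w′ ‖
  ‖++ʷ‖ [ _ ]        w′ = refl
  ‖++ʷ‖ (a ∷⟨ e ⟩ w) w′ = cong suc (‖++ʷ‖ w w′)

  EdgeSymmetric : Set
  EdgeSymmetric = ∀ {a b} → E G a b → E G b a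

  reverseʷ : EdgeSymmetric → ∀ {a b} → Walk G a b → Walk G b a
  reverseʷ E-sym [ a ]        = [ a ]
  reverseʷ E-sym (a ∷⟨ e ⟩ w) = reverseʷ E-sym w ++ʷ (_ ∷⟨ E-sym e ⟩ [ a ])

  ‖reverseʷ‖ : ∀ (E-sym : EdgeSymmetric) {a b} (w : Walk G a b) → ‖ reverseʷ E-sym w ‖ ≡ ‖ w ‖
  ‖reverseʷ‖ E-sym [ a ]        = refl
  ‖reverseʷ‖ E-sym (a ∷⟨ e ⟩ w) = begin
    ‖ reverseʷ E-sym w ++ʷ (_ ∷⟨ E-sym e ⟩ [ a ]) ‖ ≡⟨ ‖++ʷ‖ (reverseʷ E-sym w) _ ⟩
    ‖ reverseʷ E-sym w ‖ + 1                         ≡⟨ +-comm _ 1 ⟩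
    suc ‖ reverseʷ E-sym w ‖                         ≡⟨ cong suc (‖reverseʷ‖ E-sym w) ⟩
    suc ‖ w ‖                                        ∎
    where open ≡-Reasoning

  ‖‖≡0⇒≡ : ∀ {a b} (w : Walk G a b) → ‖ w ‖ ≡ 0 → a ≡ b
  ‖‖≡0⇒≡ [ a ] _ = refl

  onWalk-start : ∀ {a b} (w : Walk G a b) → OnWalk G a w
  onWalk-start [ a ]        = here-end
  onWalk-start (a ∷⟨ e ⟩ w) = here e w

  onWalk-end : ∀ {a b} (w : Walk G a b) → OnWalk G b w
  onWalk-end [ a ]        = here-end
  onWalk-end (a ∷⟨ e ⟩ w) = there e (onWalk-end w)

  onWalk-++ˡ : ∀ {x a b c} {w : Walk G a b} (w′ : Walk G b c) → OnWalk G x w → OnWalk G x (w ++ʷ w′)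
  onWalk-++ˡ w′ here-end     = onWalk-start w′
  onWalk-++ˡ w′ (here e w)   = here e (w ++ʷ w′)
  onWalk-++ˡ w′ (there e p)  = there e (onWalk-++ˡ w′ p)

  onWalk-++ʳ : ∀ {x a b c} (w : Walk G a b) {w′ : Walk G b c} → OnWalk G x w′ → OnWalk G x (w ++ʷ w′)
  onWalk-++ʳ [ a ]        p = p
  onWalk-++ʳ (a ∷⟨ e ⟩ w) p = there e (onWalk-++ʳ w p)

  index : ∀ {x a b} {w : Walk G a b} → OnWalk G x w → ℕ
  index here-end    = 0
  index (here e w)  = 0
  index (there e p) = suc (index p)

  prefix : ∀ {x a b} {w : Walk G a b} (p : OnWalk G x w) → Σ (Walk G a x) λ w₁ → ‖ w₁ ‖ ≡ index p
  prefix here-end                    = [ _ ] , refl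
  prefix (here e w)                  = [ _ ] , refl
  prefix {w = a ∷⟨ e ⟩ _} (there e p) with w₁ , ‖w₁‖ ← prefix p = a ∷⟨ e ⟩ w₁ , cong suc ‖w₁‖

  suffix : ∀ {x a b} {w : Walk G a b} (p : OnWalk G x w) → Σ (Walk G x b) λ w₂ → index p + ‖ w₂ ‖ ≡ ‖ w ‖
  suffix here-end    = [ _ ] , refl
  suffix (here e w)  = _ ∷⟨ e ⟩ w , refl
  suffix (there e p) with w₂ , ‖w₂‖ ← suffix p = w₂ , cong suc ‖w₂‖

  segment : ∀ {x y a b} {w : Walk G a b} (p : OnWalk G x w) (q : OnWalk G y w) → index p ≤ index q →
            Σ (Walk G x y) λ s → index p + ‖ s ‖ ≡ index q
  segment here-end     here-end     _         = [ _ ] , refl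
  segment (here e w)   q            _         = prefix q
  segment (there e p)  (there e q)  (s≤s p≤q) with s , ‖s‖ ← segment p q p≤q = s , cong suc ‖s‖

module Moves (G : Graph) where

  legalMove-replace : ∀ pre {u v : V G} post → E G u v → u ≢ v →
                      GeneralPosition G (pre ++ u ∷ post) → GeneralPosition G (pre ++ v ∷ post) →
                      LegalMove G (pre ++ u ∷ post) (pre ++ v ∷ post)
  legalMove-replace pre {u} {v} post e u≢v (uniq , _) gp′@(uniq′ , _) =
    u , v , ∈-++⁺ʳ pre (here refl) , e , v∉ , uniq′ , (λ w → in-target⇒ w , ⇒in-target w) , gp′
    where
      v∉ : v ∉ pre ++ u ∷ post
      v∉ v∈ with ∈-++⁻ pre v∈
      ... | inj₁ v∈pre          = unique-middle pre uniq′ (inj₁ v∈pre) refl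
      ... | inj₂ (here v≡u)     = u≢v (sym v≡u)
      ... | inj₂ (there v∈post) = unique-middle pre uniq′ (inj₂ v∈post) refl
      in-target⇒ : ∀ w → w ∈ pre ++ v ∷ post → (w ∈ pre ++ u ∷ post × w ≢ u) ⊎ w ≡ v
      in-target⇒ w w∈ with ∈-++⁻ pre w∈
      ... | inj₁ w∈pre          = inj₁ (∈-++⁺ˡ w∈pre , unique-middle pre uniq (inj₁ w∈pre))
      ... | inj₂ (here refl)    = inj₂ refl
      ... | inj₂ (there w∈post) = inj₁ (∈-++⁺ʳ pre (there w∈post) , unique-middle pre uniq (inj₂ w∈post))
      ⇒in-target : ∀ w → (w ∈ pre ++ u ∷ post × w ≢ u) ⊎ w ≡ v → w ∈ pre ++ v ∷ post
      ⇒in-target w (inj₂ refl) = ∈-++⁺ʳ pre (here refl)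
      ⇒in-target w (inj₁ (w∈ , w≢u)) with ∈-++⁻ pre w∈
      ... | inj₁ w∈pre           = ∈-++⁺ˡ w∈pre
      ... | inj₂ (here refl)     = ⊥-elim (w≢u refl)
      ... | inj₂ (there w∈post)  = ∈-++⁺ʳ pre (there w∈post)

  data MovePath : List (V G) → List (V G) → List (List (V G)) → Set where
    done : ∀ {S} → MovePath S S []
    step : ∀ {S S′ T tr} → LegalMove G S S′ → MovePath S′ T tr → MovePath S T (S ∷ tr)

  toMoveSeq : ∀ {S T tr} → MovePath S T tr → MoveSeq G S (tr ++ T ∷ [])
  toMoveSeq done       = stop _
  toMoveSeq (step m p) = move m (toMoveSeq p)

  infixr 5 _++ᵖ_

  _++ᵖ_ : ∀ {S T U tr tr′} → MovePath S T tr → MovePath T U tr′ → MovePath S U (tr ++ tr′)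
  done       ++ᵖ q = q
  step m p   ++ᵖ q = step m (p ++ᵖ q)

  mapPath : (f : List (V G) → List (V G)) → (∀ {S S′} → LegalMove G S S′ → LegalMove G (f S) (f S′)) →
            ∀ {S T tr} → MovePath S T tr → MovePath (f S) (f T) (map f tr)
  mapPath f f-move done       = done
  mapPath f f-move (step m p) = step (f-move m) (mapPath f f-move p)

module ShortestPaths (G : Graph) (d : V G → V G → ℕ)
  (d≤‖_‖ : ∀ {u v} (w : Walk G u v) → d u v ≤ walkLength G w)
  (geodesic : ∀ u v → Σ (Walk G u v) λ w → walkLength G w ≡ d u v)
  (d-sym : ∀ u v → d u v ≡ d v u) where

  open Walks G
  open Moves G

  triangle : ∀ x y z → d x z ≤ d x y + d y z
  triangle x y z with w₁ , ‖w₁‖ ← geodesic x y | w₂ , ‖w₂‖ ← geodesic y z =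
    ≤-trans d≤‖ w₁ ++ʷ w₂ ‖ (≤-reflexive (trans (‖++ʷ‖ w₁ w₂) (cong₂ _+_ ‖w₁‖ ‖w₂‖)))

  d-refl : ∀ u → d u u ≡ 0
  d-refl u = n≤0⇒n≡0 d≤‖ [ u ] ‖

  d≡0⇒≡ : ∀ {u v} → d u v ≡ 0 → u ≡ v
  d≡0⇒≡ {u} {v} d≡0 with w , ‖w‖ ← geodesic u v = ‖‖≡0⇒≡ w (trans ‖w‖ d≡0)

  Between : V G → V G → V G → Set
  Between x y z = d x y + d y z ≡ d x z

  data Collinear (x y z : V G) : Set where
    middle : Between x y z → Collinear x y z
    first  : Between y x z → Collinear x y z
    last   : Between x z y → Collinear x y z

  between-sym : ∀ {x y z} → Between x y z → Between z y x
  between-sym {x} {y} {z} x-y-z = begin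
    d z y + d y x ≡⟨ cong₂ _+_ (d-sym z y) (d-sym y x) ⟩
    d y z + d x y ≡⟨ +-comm (d y z) (d x y) ⟩
    d x y + d y z ≡⟨ x-y-z ⟩
    d x z         ≡⟨ d-sym x z ⟩
    d z x         ∎
    where open ≡-Reasoning

  collinear-swap₁₂ : ∀ {x y z} → Collinear x y z → Collinear y x z
  collinear-swap₁₂ (middle b) = first b
  collinear-swap₁₂ (first b)  = middle b
  collinear-swap₁₂ (last b)   = last (between-sym b)

  collinear-swap₂₃ : ∀ {x y z} → Collinear x y z → Collinear x z y
  collinear-swap₂₃ (middle b) = last b
  collinear-swap₂₃ (first b)  = first (between-sym b)
  collinear-swap₂₃ (last b)   = middle b

  OnShortestPath : V G → V G → V G → Set
  OnShortestPath x y z = Σ (V G) λ a → Σ (V G) λ b → Σ (Walk G a b) λ w →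
                           IsShortest G w × OnWalk G x w × OnWalk G y w × OnWalk G z w

  between⇒onShortestPath : ∀ {x y z} → Between x y z → OnShortestPath x y z
  between⇒onShortestPath {x} {y} {z} x-y-z with w₁ , ‖w₁‖ ← geodesic x y | w₂ , ‖w₂‖ ← geodesic y z =
    x , z , w₁ ++ʷ w₂ , shortest ,
    onWalk-++ˡ w₂ (onWalk-start w₁) , onWalk-++ʳ w₁ (onWalk-start w₂) , onWalk-++ʳ w₁ (onWalk-end w₂)
    where
      shortest : IsShortest G (w₁ ++ʷ w₂)
      shortest w = ≤-trans (≤-reflexive (trans (‖++ʷ‖ w₁ w₂) (trans (cong₂ _+_ ‖w₁‖ ‖w₂‖) x-y-z))) d≤‖ w ‖

  collinear⇒onShortestPath : ∀ {x y z} → Collinear x y z → OnShortestPath x y z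
  collinear⇒onShortestPath (middle b) = between⇒onShortestPath b
  collinear⇒onShortestPath (first b) with a , c , w , sh , y∈ , x∈ , z∈ ← between⇒onShortestPath b =
    a , c , w , sh , x∈ , y∈ , z∈
  collinear⇒onShortestPath (last b) with a , c , w , sh , x∈ , z∈ , y∈ ← between⇒onShortestPath b =
    a , c , w , sh , x∈ , y∈ , z∈

  -- A detour through a geodesic would shorten w, so every segment of w is a geodesic.
  shortest-segment : ∀ {x y a b} {w : Walk G a b} → IsShortest G w →
                     (p : OnWalk G x w) (q : OnWalk G y w) → index p ≤ index q → index p + d x y ≡ index q
  shortest-segment {x} {y} {w = w} w-shortest p q p≤q
    with w₁ , ‖w₁‖ ← prefix p | s , ‖s‖ ← segment p q p≤q | w₃ , ‖w₃‖ ← suffix q | g , ‖g‖ ← geodesic x y =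
    trans (cong (index p +_) (≤-antisym d≤‖ s ‖ s≤d)) ‖s‖
    where
      open ≡-Reasoning
      through-s : index p + (‖ s ‖ + ‖ w₃ ‖) ≡ ‖ w ‖
      through-s = trans (sym (+-assoc (index p) ‖ s ‖ ‖ w₃ ‖)) (trans (cong (_+ ‖ w₃ ‖) ‖s‖) ‖w₃‖)
      through-g : ‖ w₁ ++ʷ g ++ʷ w₃ ‖ ≡ index p + (d x y + ‖ w₃ ‖)
      through-g = begin
        ‖ w₁ ++ʷ g ++ʷ w₃ ‖         ≡⟨ ‖++ʷ‖ w₁ (g ++ʷ w₃) ⟩
        ‖ w₁ ‖ + ‖ g ++ʷ w₃ ‖       ≡⟨ cong₂ _+_ ‖w₁‖ (‖++ʷ‖ g w₃) ⟩
        index p + (‖ g ‖ + ‖ w₃ ‖)  ≡⟨ cong (λ k → index p + (k + ‖ w₃ ‖)) ‖g‖ ⟩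
        index p + (d x y + ‖ w₃ ‖)  ∎
      s≤d : ‖ s ‖ ≤ d x y
      s≤d = +-cancelʳ-≤ ‖ w₃ ‖ _ _ (+-cancelˡ-≤ (index p) _ _
              (≤-trans (≤-reflexive through-s)
                (≤-trans (w-shortest (w₁ ++ʷ g ++ʷ w₃)) (≤-reflexive through-g))))

  ordered⇒between : ∀ {x y z a b} {w : Walk G a b} → IsShortest G w →
                    (p : OnWalk G x w) (q : OnWalk G y w) (r : OnWalk G z w) →
                    index p ≤ index q → index q ≤ index r → Between x y z
  ordered⇒between {x} {y} {z} sh p q r p≤q q≤r = +-cancelˡ-≡ (index p) _ _ (begin
    index p + (d x y + d y z) ≡⟨ sym (+-assoc (index p) (d x y) (d y z)) ⟩
    index p + d x y + d y z   ≡⟨ cong (_+ d y z) (shortest-segment sh p q p≤q) ⟩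
    index q + d y z           ≡⟨ shortest-segment sh q r q≤r ⟩
    index r                   ≡⟨ sym (shortest-segment sh p r (≤-trans p≤q q≤r)) ⟩
    index p + d x z           ∎)
    where open ≡-Reasoning

  onShortestPath⇒collinear : ∀ {x y z} → OnShortestPath x y z → Collinear x y z
  onShortestPath⇒collinear (_ , _ , w , sh , p , q , r)
    with ≤-total (index p) (index q) | ≤-total (index q) (index r) | ≤-total (index p) (index r)
  ... | inj₁ p≤q | inj₁ q≤r | _        = middle (ordered⇒between sh p q r p≤q q≤r)
  ... | inj₁ p≤q | inj₂ r≤q | inj₁ p≤r = last (ordered⇒between sh p r q p≤r r≤q)
  ... | inj₁ p≤q | inj₂ r≤q | inj₂ r≤p = first (between-sym (ordered⇒between sh r p q r≤p p≤q))
  ... | inj₂ q≤p | _        | inj₁ p≤r = first (ordered⇒between sh q p r q≤p p≤r)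
  ... | inj₂ q≤p | inj₁ q≤r | inj₂ r≤p = last (between-sym (ordered⇒between sh q r p q≤r r≤p))
  ... | inj₂ q≤p | inj₂ r≤q | inj₂ _   = middle (between-sym (ordered⇒between sh r q p r≤q q≤p))

  NoCollinear : List (V G) → Set
  NoCollinear S = ∀ {x y z} → x ∈ S → y ∈ S → z ∈ S → x ≢ y → y ≢ z → x ≢ z → ¬ Collinear x y z

  generalPosition : ∀ {S} → Unique S → NoCollinear S → GeneralPosition G S
  generalPosition uniq nc =
    uniq , λ _ _ _ x∈ y∈ z∈ x≢y y≢z x≢z → nc x∈ y∈ z∈ x≢y y≢z x≢z ∘ onShortestPath⇒collinear

  generalPosition⇒noCollinear : ∀ {S} → GeneralPosition G S → NoCollinear S
  generalPosition⇒noCollinear (_ , gp) x∈ y∈ z∈ x≢y y≢z x≢z =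
    gp _ _ _ x∈ y∈ z∈ x≢y y≢z x≢z ∘ collinear⇒onShortestPath

  private
    ¬collinear-lookup : ∀ {x y z S} → AllPairs (λ y z → ¬ Collinear x y z) S →
                        y ∈ S → z ∈ S → y ≢ z → ¬ Collinear x y z
    ¬collinear-lookup xs y∈ z∈ y≢z = [ id , (λ ¬xzy → ¬xzy ∘ collinear-swap₂₃) ]′ (allPairs-lookup xs y∈ z∈ y≢z)

  noCollinear-[] : NoCollinear []
  noCollinear-[] ()

  noCollinear-∷ : ∀ {x S} → AllPairs (λ y z → ¬ Collinear x y z) S → NoCollinear S → NoCollinear (x ∷ S)
  noCollinear-∷ _  _  (here refl) (here refl) _           x≢y _   _   = ⊥-elim (x≢y refl)
  noCollinear-∷ _  _  (here refl) (there _)   (here refl) _   _   x≢z = ⊥-elim (x≢z refl)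
  noCollinear-∷ _  _  (there _)   (here refl) (here refl) _   y≢z _   = ⊥-elim (y≢z refl)
  noCollinear-∷ xs _  (here refl) (there y∈)  (there z∈)  _   y≢z _   =
    ¬collinear-lookup xs y∈ z∈ y≢z
  noCollinear-∷ xs _  (there x∈)  (here refl) (there z∈)  _   _   x≢z =
    ¬collinear-lookup xs x∈ z∈ x≢z ∘ collinear-swap₁₂
  noCollinear-∷ xs _  (there x∈)  (there y∈)  (here refl) x≢y _   _   =
    ¬collinear-lookup xs x∈ y∈ x≢y ∘ collinear-swap₁₂ ∘ collinear-swap₂₃
  noCollinear-∷ _  nc (there x∈)  (there y∈)  (there z∈)  = nc x∈ y∈ z∈

  noCollinear₂ : ∀ {u v} → NoCollinear (u ∷ v ∷ [])
  noCollinear₂ = noCollinear-∷ ([] ∷ []) (noCollinear-∷ [] noCollinear-[])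

  generalPosition₂ : ∀ {u v} → u ≢ v → GeneralPosition G (u ∷ v ∷ [])
  generalPosition₂ u≢v = generalPosition ((u≢v ∷ []) ∷ [] ∷ []) noCollinear₂

  noCollinear₃ : ∀ {u v w} → ¬ Collinear u v w → NoCollinear (u ∷ v ∷ w ∷ [])
  noCollinear₃ ¬uvw = noCollinear-∷ ((¬uvw ∷ []) ∷ [] ∷ []) noCollinear₂

  noCollinear₄ : ∀ {u v w x} → ¬ Collinear u v w → ¬ Collinear u v x → ¬ Collinear u w x → ¬ Collinear v w x →
                 NoCollinear (u ∷ v ∷ w ∷ x ∷ [])
  noCollinear₄ ¬uvw ¬uvx ¬uwx ¬vwx =
    noCollinear-∷ ((¬uvw ∷ ¬uvx ∷ []) ∷ (¬uwx ∷ []) ∷ [] ∷ []) (noCollinear₃ ¬vwx)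

  module Symmetry (σ : V G → V G) (σ-isometry : ∀ u v → d (σ u) (σ v) ≡ d u v)
                  (σ-edge : ∀ {u v} → E G u v → E G (σ u) (σ v)) where

    σ-injective : ∀ {u v} → σ u ≡ σ v → u ≡ v
    σ-injective {u} {v} σu≡σv =
      d≡0⇒≡ (trans (sym (σ-isometry u v)) (trans (cong (d (σ u)) (sym σu≡σv)) (d-refl (σ u))))

    between-reflect : ∀ {x y z} → Between (σ x) (σ y) (σ z) → Between x y z
    between-reflect {x} {y} {z} b =
      trans (sym (cong₂ _+_ (σ-isometry x y) (σ-isometry y z))) (trans b (σ-isometry x z))

    collinear-reflect : ∀ {x y z} → Collinear (σ x) (σ y) (σ z) → Collinear x y z
    collinear-reflect (middle b) = middle (between-reflect b)
    collinear-reflect (first b)  = first (between-reflect b)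
    collinear-reflect (last b)   = last (between-reflect b)

    generalPosition-map : ∀ {S} → GeneralPosition G S → GeneralPosition G (map σ S)
    generalPosition-map {S} gp = generalPosition (Unique.map⁺ σ-injective (proj₁ gp)) nc
      where
        nc : NoCollinear (map σ S)
        nc x∈ y∈ z∈ x≢y y≢z x≢z col with ∈-map⁻ σ x∈ | ∈-map⁻ σ y∈ | ∈-map⁻ σ z∈
        ... | _ , x₀∈ , refl | _ , y₀∈ , refl | _ , z₀∈ , refl =
          generalPosition⇒noCollinear gp x₀∈ y₀∈ z₀∈ (x≢y ∘ cong σ) (y≢z ∘ cong σ) (x≢z ∘ cong σ)
            (collinear-reflect col)

    legalMove-map : ∀ {S S′} → LegalMove G S S′ → LegalMove G (map σ S) (map σ S′)
    legalMove-map {S} {S′} (u , v , u∈ , e , v∉ , uniq′ , members , gp′) =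
      σ u , σ v , ∈-map⁺ σ u∈ , σ-edge e , σv∉ , Unique.map⁺ σ-injective uniq′ ,
      (λ w → in-target⇒ w , ⇒in-target w) , generalPosition-map gp′
      where
        σv∉ : σ v ∉ map σ S
        σv∉ σv∈ with _ , v₀∈ , σv≡σv₀ ← ∈-map⁻ σ σv∈ = v∉ (subst (_∈ S) (σ-injective (sym σv≡σv₀)) v₀∈)
        in-target⇒ : ∀ w → w ∈ map σ S′ → (w ∈ map σ S × w ≢ σ u) ⊎ w ≡ σ v
        in-target⇒ w w∈ with w₀ , w₀∈ , refl ← ∈-map⁻ σ w∈ with proj₁ (members w₀) w₀∈
        ... | inj₁ (w₀∈S , w₀≢u) = inj₁ (∈-map⁺ σ w₀∈S , w₀≢u ∘ σ-injective)
        ... | inj₂ w₀≡v          = inj₂ (cong σ w₀≡v)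
        ⇒in-target : ∀ w → (w ∈ map σ S × w ≢ σ u) ⊎ w ≡ σ v → w ∈ map σ S′
        ⇒in-target w (inj₂ refl) = ∈-map⁺ σ (proj₂ (members v) (inj₂ refl))
        ⇒in-target w (inj₁ (w∈ , w≢σu)) with w₀ , w₀∈ , refl ← ∈-map⁻ σ w∈ =
          ∈-map⁺ σ (proj₂ (members w₀) (inj₁ (w₀∈ , w≢σu ∘ cong σ)))

    ∈-iterate : ∀ k {y S} → y ∈ S → (σ ^ k) y ∈ (map σ ^ k) S
    ∈-iterate zero    y∈ = y∈
    ∈-iterate (suc k) y∈ = ∈-map⁺ σ (∈-iterate k y∈)

    configuration : List (V G) → ℕ → List (V G)
    configuration S k = (map σ ^ k) S

    module _ {S tr} (round₀ : MovePath S (map σ S) (S ∷ tr)) where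

      Round : ℕ → Set
      Round k = Σ (List (List (V G))) λ rest →
                  MovePath (configuration S k) (configuration S (suc k)) (configuration S k ∷ rest)

      rounds : ∀ N → Round N × Σ (List (List (V G))) λ tr′ →
               MovePath S (configuration S N) tr′ × (∀ k → k < N → configuration S k ∈ tr′)
      rounds zero = (tr , round₀) , [] , done , λ _ ()
      rounds (suc N) with (rest , r) , tr′ , p , visits ← rounds N =
        (map (map σ) rest , mapPath (map σ) legalMove-map r) ,
        tr′ ++ configuration S N ∷ rest , p ++ᵖ r , visits′
        where
          visits′ : ∀ k → k < suc N → configuration S k ∈ tr′ ++ configuration S N ∷ rest
          visits′ k k<1+N with m<1+n⇒m<n∨m≡n k<1+N
          ... | inj₁ k<N  = ∈-++⁺ˡ (visits k k<N)
          ... | inj₂ refl = ∈-++⁺ʳ tr′ (here refl)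

    -- Repeating a round that carries S onto its image under σ, transported by the powers of σ,
    -- moves every robot through all of its σ-images.
    mobile-by-symmetry : ∀ {S tr} → GeneralPosition G S → MovePath S (map σ S) (S ∷ tr) → (N : ℕ) →
                         (∀ x → Σ (V G) λ y → Σ ℕ λ k → k < N × y ∈ S × (σ ^ k) y ≡ x) → Mobile G S
    mobile-by-symmetry {S} gp round₀ N covered with _ , tr′ , p , visits ← rounds round₀ N =
      gp , tr′ ++ configuration S N ∷ [] , toMoveSeq p , cover
      where
        cover : ∀ x → Σ (List (V G)) λ T → T ∈ tr′ ++ configuration S N ∷ [] × x ∈ T
        cover x with y , k , k<N , y∈ , refl ← covered x =
          configuration S k , ∈-++⁺ˡ (visits k k<N) , ∈-iterate k y∈

module Prism (n : ℕ) .{{_ : NonZero n}} where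

  G : Graph
  G = Cycle n □ K₂

  Vertex : Set
  Vertex = Fin n × Fin 2

  position : Vertex → ℕ
  position = toℕ ∘ proj₁

  position≢⇒≢ : ∀ {u v} → position u ≢ position v → u ≢ v
  position≢⇒≢ u≢v refl = u≢v refl

  open Walks G public
  open Moves G public

  rot : Fin n → Fin n
  rot i = suc (toℕ i) mod n

  toℕ-rot : ∀ i → toℕ (rot i) ≡ suc (toℕ i) % n
  toℕ-rot i = toℕ-fromℕ< (m%n<n (suc (toℕ i)) n)

  rot-step : ∀ i → toℕ (rot i) ≡ suc (toℕ i) ⊎ (suc (toℕ i) ≡ n × toℕ (rot i) ≡ 0)
  rot-step i with m≤n⇒m<n∨m≡n (toℕ<n i)
  ... | inj₁ 1+i<n = inj₁ (trans (toℕ-rot i) (m<n⇒m%n≡m 1+i<n))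
  ... | inj₂ 1+i≡n = inj₂ (1+i≡n , trans (toℕ-rot i) (trans (cong (_% n) 1+i≡n) (n%n≡0 n)))

  rot-suc : ∀ {i j} → suc (toℕ i) ≡ toℕ j → rot i ≡ j
  rot-suc {i} {j} e = toℕ-injective (trans (toℕ-rot i) (trans (cong (_% n) e) (m<n⇒m%n≡m (toℕ<n j))))

  rot-last : ∀ {i j} → suc (toℕ i) ≡ n → toℕ j ≡ 0 → rot i ≡ j
  rot-last {i} e j≡0 = toℕ-injective (trans (toℕ-rot i) (trans (cong (_% n) e) (trans (n%n≡0 n) (sym j≡0))))

  cycleE⇒rot : ∀ {i j} → CycleE n i j → rot i ≡ j ⊎ rot j ≡ i
  cycleE⇒rot (inj₁ e)                      = inj₁ (rot-suc e)
  cycleE⇒rot (inj₂ (inj₁ e))               = inj₂ (rot-suc e)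
  cycleE⇒rot (inj₂ (inj₂ (inj₁ (i≡0 , e)))) = inj₂ (rot-last e i≡0)
  cycleE⇒rot (inj₂ (inj₂ (inj₂ (j≡0 , e)))) = inj₁ (rot-last e j≡0)

  cycleE-rot : ∀ i → CycleE n i (rot i)
  cycleE-rot i with rot-step i
  ... | inj₁ e          = inj₁ (sym e)
  ... | inj₂ (e , r≡0) = inj₂ (inj₂ (inj₂ (r≡0 , e)))

  cycleE-sym : ∀ {i j} → CycleE n i j → CycleE n j i
  cycleE-sym (inj₁ e)               = inj₂ (inj₁ e)
  cycleE-sym (inj₂ (inj₁ e))        = inj₁ e
  cycleE-sym (inj₂ (inj₂ (inj₁ p))) = inj₂ (inj₂ (inj₂ p))
  cycleE-sym (inj₂ (inj₂ (inj₂ p))) = inj₂ (inj₂ (inj₁ p))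

  E-sym : EdgeSymmetric
  E-sym (inj₁ (refl , a≢b)) = inj₁ (refl , a≢b ∘ sym)
  E-sym (inj₂ (c , refl))   = inj₂ (cycleE-sym c , refl)

  ρ : Vertex → Vertex
  ρ (i , a) = rot i , a

  ρ-suc : ∀ {i j : Fin n} {a} → suc (toℕ i) ≡ toℕ j → ρ (i , a) ≡ (j , a)
  ρ-suc 1+i≡j = cong (_, _) (rot-suc 1+i≡j)

  ρ-adjacent : ∀ u → E G u (ρ u)
  ρ-adjacent (i , a) = inj₂ (cycleE-rot i , refl)

  ρ-edge : ∀ {u v} → E G u v → E G (ρ u) (ρ v)
  ρ-edge (inj₁ (refl , a≢b)) = inj₁ (refl , a≢b)
  ρ-edge {i , a} {j , _} (inj₂ (c , refl)) with cycleE⇒rot c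
  ... | inj₁ refl = inj₂ (cycleE-rot (rot i) , refl)
  ... | inj₂ refl = inj₂ (cycleE-sym (cycleE-rot (rot j)) , refl)

  suc-% : ∀ m → suc (m % n) % n ≡ suc m % n
  suc-% m = begin
    (1 + m % n) % n           ≡⟨ %-distribˡ-+ 1 (m % n) n ⟩
    (1 % n + m % n % n) % n   ≡⟨ cong (λ t → (1 % n + t) % n) (m%n%n≡m%n m n) ⟩
    (1 % n + m % n) % n       ≡⟨ %-distribˡ-+ 1 m n ⟨
    (1 + m) % n               ∎
    where open ≡-Reasoning

  ρ^-position : ∀ k i a → (ρ ^ k) (i , a) ≡ ((toℕ i + k) mod n , a)
  ρ^-position zero i a = cong (_, a) (toℕ-injective (sym (begin
    toℕ ((toℕ i + 0) mod n) ≡⟨ toℕ-fromℕ< _ ⟩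
    (toℕ i + 0) % n         ≡⟨ cong (_% n) (+-identityʳ (toℕ i)) ⟩
    toℕ i % n               ≡⟨ m<n⇒m%n≡m (toℕ<n i) ⟩
    toℕ i                   ∎)))
    where open ≡-Reasoning
  ρ^-position (suc k) i a = trans (cong ρ (ρ^-position k i a)) (cong (_, a) (toℕ-injective (begin
    toℕ (rot ((toℕ i + k) mod n))   ≡⟨ toℕ-rot _ ⟩
    suc (toℕ ((toℕ i + k) mod n)) % n ≡⟨ cong (λ t → suc t % n) (toℕ-fromℕ< _) ⟩
    suc ((toℕ i + k) % n) % n        ≡⟨ suc-% (toℕ i + k) ⟩
    suc (toℕ i + k) % n              ≡⟨ cong (_% n) (+-suc (toℕ i) k) ⟨
    (toℕ i + suc k) % n              ≡⟨ toℕ-fromℕ< _ ⟨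
    toℕ ((toℕ i + suc k) mod n)      ∎)))
    where open ≡-Reasoning

  ρ^-reaches : ∀ k {i j} a → (toℕ i + k) % n ≡ toℕ j → (ρ ^ k) (i , a) ≡ (j , a)
  ρ^-reaches k {i} a e = trans (ρ^-position k i a) (cong (_, a) (toℕ-injective (trans (toℕ-fromℕ< _) e)))

  shortArc : ℕ → ℕ
  shortArc k = k ⊓ (n ∸ k)

  dC : ℕ → ℕ → ℕ
  dC x y = shortArc ∣ x - y ∣

  dK : Fin 2 → Fin 2 → ℕ
  dK a b = ∣ toℕ a - toℕ b ∣

  d : Vertex → Vertex → ℕ
  d (i , a) (j , b) = dC (toℕ i) (toℕ j) + dK a b

  dC-sym : ∀ x y → dC x y ≡ dC y x
  dC-sym x y = cong shortArc (∣-∣-comm x y)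

  d-sym : ∀ u v → d u v ≡ d v u
  d-sym (i , a) (j , b) = cong₂ _+_ (dC-sym (toℕ i) (toℕ j)) (∣-∣-comm (toℕ a) (toℕ b))

  dK≤1 : ∀ a b → dK a b ≤ 1
  dK≤1 zero       zero       = z≤n
  dK≤1 zero       (suc zero) = ≤-refl
  dK≤1 (suc zero) zero       = ≤-refl
  dK≤1 (suc zero) (suc zero) = z≤n

  shortArc-sym : ∀ {k} → k ≤ n → shortArc (n ∸ k) ≡ shortArc k
  shortArc-sym {k} k≤n = trans (cong ((n ∸ k) ⊓_) (m∸[m∸n]≡n k≤n)) (⊓-comm (n ∸ k) k)

  ∸-suc-≤ : ∀ m k → m ∸ k ≤ suc (m ∸ suc k)
  ∸-suc-≤ zero    zero    = z≤n
  ∸-suc-≤ zero    (suc k) = z≤n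
  ∸-suc-≤ (suc m) zero    = ≤-refl
  ∸-suc-≤ (suc m) (suc k) = ∸-suc-≤ m k

  Consecutive : ℕ → ℕ → Set
  Consecutive a b = suc a ≡ b ⊎ suc b ≡ a

  shortArc-consecutive : ∀ {a b} → Consecutive a b →
                         shortArc a ≤ suc (shortArc b) × shortArc b ≤ suc (shortArc a)
  shortArc-consecutive {a} (inj₁ refl) = step-down , step-up
    where
      step-down : shortArc a ≤ suc (shortArc (suc a))
      step-down = ⊓-mono-≤ (≤-trans (n≤1+n a) (n≤1+n (suc a))) (∸-suc-≤ n a)
      step-up : shortArc (suc a) ≤ suc (shortArc a)
      step-up = ⊓-mono-≤ ≤-refl (≤-trans (∸-monoʳ-≤ n (n≤1+n a)) (n≤1+n (n ∸ a)))
  shortArc-consecutive (inj₂ refl) with down , up ← shortArc-consecutive (inj₁ refl) = up , down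

  ∣suc-∣-consecutive : ∀ x z → Consecutive ∣ x - z ∣ ∣ suc x - z ∣
  ∣suc-∣-consecutive zero    zero    = inj₁ refl
  ∣suc-∣-consecutive (suc x) zero    = inj₁ refl
  ∣suc-∣-consecutive zero    (suc z) = inj₂ refl
  ∣suc-∣-consecutive (suc x) (suc z) = ∣suc-∣-consecutive x z

  dC-last : ∀ {x y} → suc y ≡ n → x ≤ y → dC x y ≡ shortArc (suc x)
  dC-last {x} {y} 1+y≡n x≤y = begin
    shortArc ∣ x - y ∣   ≡⟨ cong shortArc (m≤n⇒∣m-n∣≡n∸m x≤y) ⟩
    shortArc (y ∸ x)     ≡⟨ cong (λ m → shortArc (m ∸ suc x)) 1+y≡n ⟩
    shortArc (n ∸ suc x) ≡⟨ shortArc-sym (subst (suc x ≤_) 1+y≡n (s≤s x≤y)) ⟩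
    shortArc (suc x)     ∎
    where open ≡-Reasoning

  dC-rot-consecutive : ∀ i z → z < n →
                 Σ ℕ λ p → Σ ℕ λ q →
                   Consecutive p q × dC (toℕ i) z ≡ shortArc p × dC (toℕ (rot i)) z ≡ shortArc q
  dC-rot-consecutive i z z<n with rot-step i
  ... | inj₁ e = ∣ toℕ i - z ∣ , ∣ suc (toℕ i) - z ∣ , ∣suc-∣-consecutive (toℕ i) z , refl ,
                 cong (λ t → dC t z) e
  ... | inj₂ (1+i≡n , r≡0) = suc z , z , inj₂ refl ,
                 trans (dC-sym (toℕ i) z) (dC-last 1+i≡n (≤-pred (subst (z <_) (sym 1+i≡n) z<n))) ,
                 cong (λ t → dC t z) r≡0

  dC-rot-lipschitz : ∀ i z → z < n →
                     dC (toℕ i) z ≤ suc (dC (toℕ (rot i)) z) × dC (toℕ (rot i)) z ≤ suc (dC (toℕ i) z)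
  dC-rot-lipschitz i z z<n with p , q , adj , dp , dq ← dC-rot-consecutive i z z<n
    rewrite dp | dq = shortArc-consecutive adj

  d-edge : ∀ {u v} w → E G u v → d u w ≤ suc (d v w)
  d-edge {i , a} {_ , b} (k , c) (inj₁ (refl , _)) = begin
    dC (toℕ i) (toℕ k) + dK a c             ≤⟨ +-monoʳ-≤ (dC (toℕ i) (toℕ k)) dK-step ⟩
    dC (toℕ i) (toℕ k) + suc (dK b c)       ≡⟨ +-suc _ _ ⟩
    suc (dC (toℕ i) (toℕ k) + dK b c)       ∎
    where
      open ≤-Reasoning
      dK-step : dK a c ≤ suc (dK b c)
      dK-step = ≤-trans (∣-∣-triangle (toℕ a) (toℕ b) (toℕ c)) (+-monoˡ-≤ (dK b c) (dK≤1 a b))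
  d-edge {i , a} {j , _} (k , c) (inj₂ (cyc , refl)) = +-monoˡ-≤ (dK a c) (dC-step (cycleE⇒rot cyc))
    where
      dC-step : rot i ≡ j ⊎ rot j ≡ i → dC (toℕ i) (toℕ k) ≤ suc (dC (toℕ j) (toℕ k))
      dC-step (inj₁ refl) = proj₁ (dC-rot-lipschitz i (toℕ k) (toℕ<n k))
      dC-step (inj₂ refl) = proj₂ (dC-rot-lipschitz j (toℕ k) (toℕ<n k))

  d≤‖_‖ : ∀ {u v} (w : Walk G u v) → d u v ≤ ‖ w ‖
  d≤‖ [ i , a ] ‖      = ≤-reflexive (cong₂ _+_ (cong shortArc (∣n-n∣≡0 (toℕ i))) (∣n-n∣≡0 (toℕ a)))
  d≤‖ u ∷⟨ e ⟩ w ‖ = ≤-trans (d-edge _ e) (s≤s d≤‖ w ‖)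

  forward : ∀ k u → Σ (Walk G u ((ρ ^ k) u)) λ w → ‖ w ‖ ≡ k
  forward zero    u = [ u ] , refl
  forward (suc k) u with w , ‖w‖ ← forward k u =
    w ++ʷ (_ ∷⟨ ρ-adjacent _ ⟩ [ _ ]) , trans (‖++ʷ‖ w _) (trans (+-comm _ 1) (cong suc ‖w‖))

  forward-to : ∀ k {i j} a → (toℕ i + k) % n ≡ toℕ j → Σ (Walk G (i , a) (j , a)) λ w → ‖ w ‖ ≡ k
  forward-to k a e = subst (λ v → Σ (Walk G _ v) λ w → ‖ w ‖ ≡ k) (ρ^-reaches k a e) (forward k _)

  layer-geodesic≤ : ∀ {i j} a → toℕ i ≤ toℕ j → Σ (Walk G (i , a) (j , a)) λ w → ‖ w ‖ ≡ dC (toℕ i) (toℕ j)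
  layer-geodesic≤ {i} {j} a i≤j =
    subst (λ m → Σ (Walk G (i , a) (j , a)) λ w → ‖ w ‖ ≡ shortArc m) (sym (m≤n⇒∣m-n∣≡n∸m i≤j))
          (shorter-way (≤-total k (n ∸ k)))
    where
      open ≡-Reasoning
      x = toℕ i
      y = toℕ j
      k = y ∸ x
      k≤n : k ≤ n
      k≤n = ≤-trans (m∸n≤m y x) (<⇒≤ (toℕ<n j))
      clockwise : (x + k) % n ≡ y
      clockwise = trans (cong (_% n) (m+[n∸m]≡n i≤j)) (m<n⇒m%n≡m (toℕ<n j))
      counterclockwise : (y + (n ∸ k)) % n ≡ x
      counterclockwise = begin
        (y + (n ∸ k)) % n       ≡⟨ cong (λ t → (t + (n ∸ k)) % n) (m∸n+n≡m i≤j) ⟨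
        (k + x + (n ∸ k)) % n   ≡⟨ cong (λ t → (t + (n ∸ k)) % n) (+-comm k x) ⟩
        (x + k + (n ∸ k)) % n   ≡⟨ cong (_% n) (+-assoc x k (n ∸ k)) ⟩
        (x + (k + (n ∸ k))) % n ≡⟨ cong (λ t → (x + t) % n) (m+[n∸m]≡n k≤n) ⟩
        (x + n) % n             ≡⟨ [m+n]%n≡m%n x n ⟩
        x % n                   ≡⟨ m<n⇒m%n≡m (toℕ<n i) ⟩
        x                       ∎
      shorter-way : k ≤ n ∸ k ⊎ n ∸ k ≤ k → Σ (Walk G (i , a) (j , a)) λ w → ‖ w ‖ ≡ shortArc k
      shorter-way (inj₁ k≤n-k) with w , ‖w‖ ← forward-to k a clockwise =
        w , trans ‖w‖ (sym (m≤n⇒m⊓n≡m k≤n-k))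
      shorter-way (inj₂ n-k≤k) with w , ‖w‖ ← forward-to (n ∸ k) a counterclockwise =
        reverseʷ E-sym w , trans (‖reverseʷ‖ E-sym w) (trans ‖w‖ (sym (m≥n⇒m⊓n≡n n-k≤k)))

  layer-geodesic : ∀ i j a → Σ (Walk G (i , a) (j , a)) λ w → ‖ w ‖ ≡ dC (toℕ i) (toℕ j)
  layer-geodesic i j a with ≤-total (toℕ i) (toℕ j)
  ... | inj₁ i≤j = layer-geodesic≤ a i≤j
  ... | inj₂ j≤i with w , ‖w‖ ← layer-geodesic≤ a j≤i =
    reverseʷ E-sym w , trans (‖reverseʷ‖ E-sym w) (trans ‖w‖ (dC-sym (toℕ j) (toℕ i)))

  geodesic : ∀ u v → Σ (Walk G u v) λ w → ‖ w ‖ ≡ d u v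
  geodesic (i , a) (j , b) = change-layer a b
    where
      same : ∀ c → Σ (Walk G (i , c) (j , c)) λ w → ‖ w ‖ ≡ d (i , c) (j , c)
      same c with w , ‖w‖ ← layer-geodesic i j c =
        w , trans ‖w‖ (sym (trans (cong (dC (toℕ i) (toℕ j) +_) (∣n-n∣≡0 (toℕ c))) (+-identityʳ _)))
      across : ∀ c c′ → c ≢ c′ → dK c c′ ≡ 1 → Σ (Walk G (i , c) (j , c′)) λ w → ‖ w ‖ ≡ d (i , c) (j , c′)
      across c c′ c≢c′ dK≡1 with w , ‖w‖ ← layer-geodesic i j c =
        w ++ʷ (_ ∷⟨ inj₁ (refl , c≢c′) ⟩ [ _ ]) , trans (‖++ʷ‖ w _) (cong₂ _+_ ‖w‖ (sym dK≡1))
      change-layer : ∀ a b → Σ (Walk G (i , a) (j , b)) λ w → ‖ w ‖ ≡ d (i , a) (j , b)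
      change-layer zero       zero       = same zero
      change-layer zero       (suc zero) = across zero (suc zero) (λ ()) refl
      change-layer (suc zero) zero       = across (suc zero) zero (λ ()) refl
      change-layer (suc zero) (suc zero) = same (suc zero)

  dC-rot : ∀ i j → dC (toℕ (rot i)) (toℕ (rot j)) ≡ dC (toℕ i) (toℕ j)
  dC-rot i j with rot-step i | rot-step j
  ... | inj₁ ri | inj₁ rj = cong₂ dC ri rj
  ... | inj₁ ri | inj₂ (1+j≡n , rj≡0) =
    trans (cong₂ dC ri rj≡0) (sym (dC-last 1+j≡n (≤-pred (subst (suc (toℕ i) ≤_) (sym 1+j≡n) (toℕ<n i)))))
  ... | inj₂ (1+i≡n , ri≡0) | inj₁ rj =
    trans (cong₂ dC ri≡0 rj) (sym (trans (dC-sym (toℕ i) (toℕ j))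
      (dC-last 1+i≡n (≤-pred (subst (suc (toℕ j) ≤_) (sym 1+i≡n) (toℕ<n j))))))
  ... | inj₂ (1+i≡n , ri≡0) | inj₂ (1+j≡n , rj≡0) =
    trans (cong₂ dC ri≡0 rj≡0) (sym (trans (cong (λ t → dC t (toℕ j)) i≡j) (cong shortArc (∣n-n∣≡0 (toℕ j)))))
    where i≡j = suc-injective (trans 1+i≡n (sym 1+j≡n))

  ρ-isometry : ∀ u v → d (ρ u) (ρ v) ≡ d u v
  ρ-isometry (i , a) (j , b) = cong (_+ dK a b) (dC-rot i j)

  open ShortestPaths G d d≤‖_‖ geodesic d-sym public
  open Symmetry ρ ρ-isometry ρ-edge public

  _≟ᵛ_ : (u v : Vertex) → Dec (u ≡ v)
  _≟ᵛ_ = ≡-dec _≟ᶠ_ _≟ᶠ_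

  collinear? : ∀ x y z → Dec (Collinear x y z)
  collinear? x y z with d x y + d y z ≟ d x z | d y x + d x z ≟ d y z | d x z + d z y ≟ d x y
  ... | yes b | _     | _     = yes (middle b)
  ... | no _  | yes b | _     = yes (first b)
  ... | no _  | no _  | yes b = yes (last b)
  ... | no ¬m | no ¬f | no ¬l = no λ { (middle b) → ¬m b ; (first b) → ¬f b ; (last b) → ¬l b }

  edge? : ∀ u v → Dec (E G u v)
  edge? (i , a) (j , b) =
    ((i ≟ᶠ j) ×-dec ¬? (a ≟ᶠ b)) ⊎-dec
    (((suc (toℕ i) ≟ toℕ j) ⊎-dec (suc (toℕ j) ≟ toℕ i) ⊎-dec
      ((toℕ i ≟ 0) ×-dec (suc (toℕ j) ≟ n)) ⊎-dec ((toℕ j ≟ 0) ×-dec (suc (toℕ i) ≟ n))) ×-dec (a ≟ᶠ b))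

  ∀-vertex? : {P : Vertex → Set} → (∀ v → Dec (P v)) → Dec (∀ v → P v)
  ∀-vertex? P? = map′ (λ h (i , a) → h i a) (λ h i a → h (i , a)) (all? λ i → all? λ a → P? (i , a))

module Arcs (n : ℕ) .{{_ : NonZero n}} where
  open Prism n

  shortArc-short : ∀ {k} → k + k ≤ n → shortArc k ≡ k
  shortArc-short {k} 2k≤n = m≤n⇒m⊓n≡m (m+n≤o⇒m≤o∸n k 2k≤n)

  shortArc-long : ∀ {k} → n ≤ k + k → shortArc k ≡ n ∸ k
  shortArc-long {k} n≤2k = m≥n⇒m⊓n≡n (m≤n+o⇒m∸n≤o n k n≤2k)

  -- Three points cut the cycle into arcs P, Q, R; the point opposite R lies between the
  -- other two exactly when R is at least half of the cycle.
  arcs-between : ∀ P Q R → P + Q + R ≡ n → n ≤ R + R → shortArc P + shortArc Q ≡ shortArc R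
  arcs-between P Q R P+Q+R≡n n≤2R = begin
    shortArc P + shortArc Q ≡⟨ cong₂ _+_ (shortArc-short {P} 2P≤n) (shortArc-short {Q} 2Q≤n) ⟩
    P + Q                   ≡⟨ m+n∸n≡m (P + Q) R ⟨
    P + Q + R ∸ R           ≡⟨ cong (_∸ R) P+Q+R≡n ⟩
    n ∸ R                   ≡⟨ shortArc-long {R} n≤2R ⟨
    shortArc R              ∎
    where
      open ≡-Reasoning
      P+Q≤R : P + Q ≤ R
      P+Q≤R = +-cancelʳ-≤ R (P + Q) R (≤-trans (≤-reflexive P+Q+R≡n) n≤2R)
      P+[Q+R]≡n : P + (Q + R) ≡ n
      P+[Q+R]≡n = trans (sym (+-assoc P Q R)) P+Q+R≡n
      2P≤n : P + P ≤ n
      2P≤n = ≤-trans (+-monoʳ-≤ P (≤-trans (m≤m+n P Q) (≤-trans P+Q≤R (m≤n+m R Q)))) (≤-reflexive P+[Q+R]≡n)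
      2Q≤n : Q + Q ≤ n
      2Q≤n = ≤-trans (+-monoʳ-≤ Q (≤-trans (m≤n+m Q P) (≤-trans P+Q≤R (m≤n+m R P))))
                     (≤-reflexive (trans (x∙yz≈y∙xz Q P R) P+[Q+R]≡n))

  arcs-between⁻¹ : ∀ P Q R → P + Q + R ≡ n → 0 < P → 0 < Q → shortArc P + shortArc Q ≡ shortArc R → n ≤ R + R
  arcs-between⁻¹ P Q R P+Q+R≡n 0<P 0<Q sum with n ≤? R + R
  ... | yes n≤2R = n≤2R
  ... | no  n≰2R = contradiction sum (<⇒≢ R<sum ∘ sym)
    where
      open ≤-Reasoning
      2R<n : R + R < n
      2R<n = ≰⇒> n≰2R
      P+[Q+R]≡n : P + (Q + R) ≡ n
      P+[Q+R]≡n = trans (sym (+-assoc P Q R)) P+Q+R≡n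
      complement-P : n ∸ P ≡ Q + R
      complement-P = trans (cong (_∸ P) (sym P+[Q+R]≡n)) (m+n∸m≡n P (Q + R))
      complement-Q : n ∸ Q ≡ P + R
      complement-Q = trans (cong (_∸ Q) (sym (trans (x∙yz≈y∙xz Q P R) P+[Q+R]≡n))) (m+n∸m≡n Q (P + R))
      R<sum : shortArc R < shortArc P + shortArc Q
      R<sum with P ≤? n ∸ P | Q ≤? n ∸ Q
      ... | no P≰ | _ = begin-strict
        shortArc R ≡⟨ shortArc-short {R} (<⇒≤ 2R<n) ⟩
        R          <⟨ +-monoˡ-≤ R 0<Q ⟩
        Q + R      ≡⟨ complement-P ⟨
        n ∸ P      ≡⟨ m≥n⇒m⊓n≡n (<⇒≤ (≰⇒> P≰)) ⟨
        shortArc P ≤⟨ m≤m+n (shortArc P) (shortArc Q) ⟩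
        shortArc P + shortArc Q ∎
      ... | yes _ | no Q≰ = begin-strict
        shortArc R ≡⟨ shortArc-short {R} (<⇒≤ 2R<n) ⟩
        R          <⟨ +-monoˡ-≤ R 0<P ⟩
        P + R      ≡⟨ complement-Q ⟨
        n ∸ Q      ≡⟨ m≥n⇒m⊓n≡n (<⇒≤ (≰⇒> Q≰)) ⟨
        shortArc Q ≤⟨ m≤n+m (shortArc Q) (shortArc P) ⟩
        shortArc P + shortArc Q ∎
      ... | yes P≤ | yes Q≤ = begin-strict
        shortArc R              ≡⟨ shortArc-short {R} (<⇒≤ 2R<n) ⟩
        R                       <⟨ +-cancelʳ-< R R (P + Q) (<-≤-trans 2R<n (≤-reflexive (sym P+Q+R≡n))) ⟩
        P + Q                   ≡⟨ cong₂ _+_ (m≤n⇒m⊓n≡m P≤) (m≤n⇒m⊓n≡m Q≤) ⟨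
        shortArc P + shortArc Q ∎

  CycleBetween : ℕ → ℕ → ℕ → Set
  CycleBetween x y z = dC x y + dC y z ≡ dC x z

  module Sorted {x y z} (x<y : x < y) (y<z : y < z) (z<n : z < n) where
    P = y ∸ x
    Q = z ∸ y
    K = z ∸ x
    R = n ∸ K

    private
      x≤z : x ≤ z
      x≤z = <⇒≤ (<-trans x<y y<z)
      K≤n : K ≤ n
      K≤n = ≤-trans (m∸n≤m z x) (<⇒≤ z<n)
      K+R≡n : K + R ≡ n
      K+R≡n = m+[n∸m]≡n K≤n
      P+Q+R≡n : P + Q + R ≡ n
      P+Q+R≡n = trans (cong (_+ R) P+Q≡K) K+R≡n
        where
          P+Q≡K : P + Q ≡ K
          P+Q≡K = +-cancelʳ-≡ x (P + Q) K (begin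
            P + Q + x   ≡⟨ xy∙z≈xz∙y P Q x ⟩
            P + x + Q   ≡⟨ cong (_+ Q) (m∸n+n≡m (<⇒≤ x<y)) ⟩
            y + Q       ≡⟨ +-comm y Q ⟩
            Q + y       ≡⟨ m∸n+n≡m (<⇒≤ y<z) ⟩
            z           ≡⟨ m∸n+n≡m x≤z ⟨
            K + x       ∎)
            where open ≡-Reasoning
      0<P : 0 < P
      0<P = m<n⇒0<n∸m x<y
      0<Q : 0 < Q
      0<Q = m<n⇒0<n∸m y<z
      0<R : 0 < R
      0<R = m<n⇒0<n∸m (≤-<-trans (m∸n≤m z x) z<n)
      dC-xy : dC x y ≡ shortArc P
      dC-xy = cong shortArc (m≤n⇒∣m-n∣≡n∸m (<⇒≤ x<y))
      dC-yz : dC y z ≡ shortArc Q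
      dC-yz = cong shortArc (m≤n⇒∣m-n∣≡n∸m (<⇒≤ y<z))
      dC-xz : dC x z ≡ shortArc R
      dC-xz = trans (cong shortArc (m≤n⇒∣m-n∣≡n∸m x≤z)) (sym (shortArc-sym K≤n))
      K+K≤n⇔n≤R+R : K + K ≤ n ⇔ n ≤ R + R
      K+K≤n⇔n≤R+R = mk⇔
        (λ 2K≤n → ≤-trans (≤-reflexive (sym K+R≡n))
                    (+-monoˡ-≤ R (+-cancelˡ-≤ K K R (≤-trans 2K≤n (≤-reflexive (sym K+R≡n))))))
        (λ n≤2R → ≤-trans (+-monoʳ-≤ K (+-cancelʳ-≤ R K R (≤-trans (≤-reflexive K+R≡n) n≤2R)))
                    (≤-reflexive K+R≡n))
      in-arcs : ∀ {a b c a′ b′ c′} → a ≡ a′ → b ≡ b′ → c ≡ c′ → a + b ≡ c ⇔ a′ + b′ ≡ c′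
      in-arcs refl refl refl = mk⇔ id id

    middle-between⇔ : CycleBetween x y z ⇔ K + K ≤ n
    middle-between⇔ = mk⇔
      (λ b → from K+K≤n⇔n≤R+R
               (arcs-between⁻¹ P Q R P+Q+R≡n 0<P 0<Q (to (in-arcs dC-xy dC-yz dC-xz) b)))
      (λ 2K≤n → from (in-arcs dC-xy dC-yz dC-xz)
               (arcs-between P Q R P+Q+R≡n (to K+K≤n⇔n≤R+R 2K≤n)))

    first-between⇔ : CycleBetween y x z ⇔ n ≤ Q + Q
    first-between⇔ = mk⇔
      (λ b → arcs-between⁻¹ P R Q P+R+Q≡n 0<P 0<R (to arcs b))
      (λ n≤2Q → from arcs (arcs-between P R Q P+R+Q≡n n≤2Q))
      where
        P+R+Q≡n = trans (sym (xy∙z≈xz∙y P Q R)) P+Q+R≡n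
        arcs = in-arcs (trans (dC-sym y x) dC-xy) dC-xz dC-yz

    last-between⇔ : CycleBetween x z y ⇔ n ≤ P + P
    last-between⇔ = mk⇔
      (λ b → arcs-between⁻¹ R Q P R+Q+P≡n 0<R 0<Q (to arcs b))
      (λ n≤2P → from arcs (arcs-between R Q P R+Q+P≡n n≤2P))
      where
        R+Q+P≡n = trans (sym (xy∙z≈zy∙x P Q R)) P+Q+R≡n
        arcs = in-arcs dC-xz (trans (dC-sym z y) dC-yz) dC-xy

module Collinearity (n : ℕ) .{{_ : NonZero n}} where
  open Prism n
  open Arcs n

  LayerBetween : Fin 2 → Fin 2 → Fin 2 → Set
  LayerBetween a b c = dK a b + dK b c ≡ dK a c

  tight-sum : ∀ {p q r s} → p ≤ q → r ≤ s → q + s ≡ p + r → q ≡ p × s ≡ r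
  tight-sum {p} {q} {r} {s} p≤q r≤s q+s≡p+r = q≡p , +-cancelˡ-≡ p s r (trans (cong (_+ s) (sym q≡p)) q+s≡p+r)
    where
      q≡p : q ≡ p
      q≡p = ≤-antisym (+-cancelʳ-≤ s q p (≤-trans (≤-reflexive q+s≡p+r) (+-monoʳ-≤ p r≤s))) p≤q

  dC-triangle : ∀ (i j k : Fin n) → dC (toℕ i) (toℕ k) ≤ dC (toℕ i) (toℕ j) + dC (toℕ j) (toℕ k)
  dC-triangle i j k =
    subst₂ _≤_ (+-identityʳ (dC x z)) (cong₂ _+_ (+-identityʳ (dC x y)) (+-identityʳ (dC y z)))
           (triangle (i , zero) (j , zero) (k , zero))
    where
      x = toℕ i
      y = toℕ j
      z = toℕ k

  between⇔ : ∀ u v w → Between u v w ⇔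
             (CycleBetween (position u) (position v) (position w) × LayerBetween (proj₂ u) (proj₂ v) (proj₂ w))
  between⇔ (i , a) (j , b) (k , c) = mk⇔
    (λ btw → tight-sum (dC-triangle i j k) (∣-∣-triangle (toℕ a) (toℕ b) (toℕ c)) (trans (sym regroup) btw))
    (λ (cb , lb) → trans regroup (cong₂ _+_ cb lb))
    where
      regroup = interchange (dC (toℕ i) (toℕ j)) (dK a b) (dC (toℕ j) (toℕ k)) (dK b c)

  mkBetween : ∀ u v w → CycleBetween (position u) (position v) (position w) →
              LayerBetween (proj₂ u) (proj₂ v) (proj₂ w) → Between u v w
  mkBetween u v w cb lb = from (between⇔ u v w) (cb , lb)

  Short Long : ℕ → Set
  Short k = k + k < n
  Long k = n < k + k

  short-mono : ∀ {k m} → k ≤ m → Short m → Short k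
  short-mono k≤m = ≤-<-trans (+-mono-≤ k≤m k≤m)

  long-mono : ∀ {k m} → k ≤ m → Long k → Long m
  long-mono k≤m long = <-≤-trans long (+-mono-≤ k≤m k≤m)

  sorted-noncollinear : ∀ {i j k : Fin n} {x y z a b c} → toℕ i ≡ x → toℕ j ≡ y → toℕ k ≡ z → x < y → y < z →
                        (¬ LayerBetween a b c ⊎ Long (z ∸ x)) → (¬ LayerBetween b a c ⊎ Short (z ∸ y)) →
                        (¬ LayerBetween a c b ⊎ Short (y ∸ x)) → ¬ Collinear (i , a) (j , b) (k , c)
  sorted-noncollinear {i} {j} {k} {a = a} {b} {c} refl refl refl x<y y<z j-outside i-outside k-outside =
    excluded
    where
      open Sorted x<y y<z (toℕ<n k)
      excluded : ¬ Collinear _ _ _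
      excluded (middle btw) with cb , lb ← to (between⇔ (i , a) (j , b) (k , c)) btw =
        [ (λ ¬lb → ¬lb lb) , (λ long → <⇒≱ long (to middle-between⇔ cb)) ]′ j-outside
      excluded (first btw) with cb , lb ← to (between⇔ (j , b) (i , a) (k , c)) btw =
        [ (λ ¬lb → ¬lb lb) , (λ short → <⇒≱ short (to first-between⇔ cb)) ]′ i-outside
      excluded (last btw) with cb , lb ← to (between⇔ (i , a) (k , c) (j , b)) btw =
        [ (λ ¬lb → ¬lb lb) , (λ short → <⇒≱ short (to last-between⇔ cb)) ]′ k-outside

  ¬LayerBetween-aba : ∀ {a b} → a ≢ b → ¬ LayerBetween a b a
  ¬LayerBetween-aba {zero}     {zero}     a≢b = ⊥-elim (a≢b refl)
  ¬LayerBetween-aba {zero}     {suc zero} _   ()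
  ¬LayerBetween-aba {suc zero} {zero}     _   ()
  ¬LayerBetween-aba {suc zero} {suc zero} a≢b = ⊥-elim (a≢b refl)

  -- Long (x₃ ∸ x₀) says that the fourth arc, from x₃ round to x₀, is shorter than n / 2.
  alternating⇒generalPosition :
    ∀ {i₀ i₁ i₂ i₃ : Fin n} {x₀ x₁ x₂ x₃ a b} →
    toℕ i₀ ≡ x₀ → toℕ i₁ ≡ x₁ → toℕ i₂ ≡ x₂ → toℕ i₃ ≡ x₃ → a ≢ b →
    x₀ < x₁ → x₁ < x₂ → x₂ < x₃ →
    Short (x₁ ∸ x₀) → Short (x₂ ∸ x₁) → Short (x₃ ∸ x₂) → Long (x₃ ∸ x₀) →
    GeneralPosition G ((i₀ , a) ∷ (i₁ , b) ∷ (i₂ , a) ∷ (i₃ , b) ∷ [])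
  alternating⇒generalPosition refl refl refl refl a≢b x₀<x₁ x₁<x₂ x₂<x₃ short₁ short₂ short₃ long =
    generalPosition
      ((ne x₀<x₁ ∷ ne x₀<x₂ ∷ ne x₀<x₃ ∷ []) ∷ (ne x₁<x₂ ∷ ne x₁<x₃ ∷ []) ∷ (ne x₂<x₃ ∷ []) ∷ [] ∷ [])
      (noCollinear₄
        (sorted-noncollinear refl refl refl x₀<x₁ x₁<x₂ (inj₁ ¬aba) (inj₂ short₂) (inj₂ short₁))
        (sorted-noncollinear refl refl refl x₀<x₁ x₁<x₃ (inj₂ long) (inj₁ ¬bab) (inj₂ short₁))
        (sorted-noncollinear refl refl refl x₀<x₂ x₂<x₃ (inj₂ long) (inj₂ short₃) (inj₁ ¬aba))
        (sorted-noncollinear refl refl refl x₁<x₂ x₂<x₃ (inj₁ ¬bab) (inj₂ short₃) (inj₂ short₂)))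
    where
      x₀<x₂ = <-trans x₀<x₁ x₁<x₂
      x₀<x₃ = <-trans x₀<x₂ x₂<x₃
      x₁<x₃ = <-trans x₁<x₂ x₂<x₃
      ¬aba = ¬LayerBetween-aba a≢b
      ¬bab = ¬LayerBetween-aba (a≢b ∘ sym)
      ne : ∀ {u v} → position u < position v → u ≢ v
      ne = position≢⇒≢ ∘ <⇒≢

module UpperBound (n : ℕ) .{{_ : NonZero n}} where
  open Prism n
  open Arcs n
  open Collinearity n

  layerBetween-end : ∀ a b → LayerBetween b a a
  layerBetween-end a b = trans (cong (dK b a +_) (∣n-n∣≡0 (toℕ a))) (+-identityʳ (dK b a))

  layerBetween-start : ∀ a b → LayerBetween a a b
  layerBetween-start a b = cong (_+ dK a b) (∣n-n∣≡0 (toℕ a))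

  rung-between : ∀ i k a b → Between (k , a) (i , a) (i , b)
  rung-between i k a b = mkBetween (k , a) (i , a) (i , b)
    (trans (cong (dC (toℕ k) (toℕ i) +_) (cong shortArc (∣n-n∣≡0 (toℕ i)))) (+-identityʳ _))
    (layerBetween-start a b)

  rung-collinear : ∀ {S} {i k : Fin n} {a b} → NoCollinear S → (k , a) ∈ S → (i , a) ∈ S → (i , b) ∈ S →
                   k ≢ i → (i , b) ≢ (i , a) → ⊥
  rung-collinear {i = i} {k} {a} {b} nc mk mi mj k≢i b≢a =
    nc mk mi mj (k≢i ∘ cong proj₁) (b≢a ∘ sym) (k≢i ∘ cong proj₁) (middle (rung-between i k a b))

  module ThreePlusOne {S} {i₁ i₂ i₃ j : Fin n} {a b} (nc : NoCollinear S)
    (m₁ : (i₁ , a) ∈ S) (m₂ : (i₂ , a) ∈ S) (m₃ : (i₃ , a) ∈ S) (mⱼ : (j , b) ∈ S)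
    (p₁<p₂ : toℕ i₁ < toℕ i₂) (p₂<p₃ : toℕ i₂ < toℕ i₃) where

    private
      p₁ = toℕ i₁
      p₂ = toℕ i₂
      p₃ = toℕ i₃
      q  = toℕ j
      p₁<p₃ = <-trans p₁<p₂ p₂<p₃

      refute : ∀ {u v w} → u ∈ S → v ∈ S → w ∈ S →
               position u ≢ position v → position v ≢ position w → position u ≢ position w → ¬ Collinear u v w
      refute u∈ v∈ w∈ uv vw uw = nc u∈ v∈ w∈ (position≢⇒≢ uv) (position≢⇒≢ vw) (position≢⇒≢ uw)

    -- In each case the four points, in cyclic order q, s, t, r, have s or r between q and t,
    -- since one of the two arcs from q to t is at least half of the cycle.
    before : q < p₁ → ⊥
    before q<p₁ with (p₂ ∸ q) + (p₂ ∸ q) ≤? n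
    ... | yes short = refute mⱼ m₁ m₂ (<⇒≢ q<p₁) (<⇒≢ p₁<p₂) (<⇒≢ q<p₂)
      (middle (mkBetween (j , b) (i₁ , a) (i₂ , a) (from middle-between⇔ short) (layerBetween-end a b)))
      where q<p₂ = <-trans q<p₁ p₁<p₂
            open Sorted q<p₁ p₁<p₂ (toℕ<n i₂)
    ... | no ¬short = refute mⱼ m₂ m₃ (<⇒≢ q<p₂) (<⇒≢ p₂<p₃) (<⇒≢ (<-trans q<p₂ p₂<p₃))
      (last (mkBetween (j , b) (i₃ , a) (i₂ , a) (from last-between⇔ (≰⇒≥ ¬short)) (layerBetween-end a b)))
      where q<p₂ = <-trans q<p₁ p₁<p₂
            open Sorted q<p₂ p₂<p₃ (toℕ<n i₃)

    inside₁₂ : p₁ < q → q < p₂ → ⊥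
    inside₁₂ p₁<q q<p₂ with (p₃ ∸ q) + (p₃ ∸ q) ≤? n
    ... | yes short = refute mⱼ m₂ m₃ (<⇒≢ q<p₂) (<⇒≢ p₂<p₃) (<⇒≢ q<p₃)
      (middle (mkBetween (j , b) (i₂ , a) (i₃ , a) (from middle-between⇔ short) (layerBetween-end a b)))
      where q<p₃ = <-trans q<p₂ p₂<p₃
            open Sorted q<p₂ p₂<p₃ (toℕ<n i₃)
    ... | no ¬short = refute m₁ mⱼ m₃ (<⇒≢ p₁<q) (<⇒≢ q<p₃) (<⇒≢ p₁<p₃)
      (first (mkBetween (j , b) (i₁ , a) (i₃ , a) (from first-between⇔ (≰⇒≥ ¬short)) (layerBetween-end a b)))
      where q<p₃ = <-trans q<p₂ p₂<p₃
            open Sorted p₁<q q<p₃ (toℕ<n i₃)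

    inside₂₃ : p₂ < q → q < p₃ → ⊥
    inside₂₃ p₂<q q<p₃ with (q ∸ p₁) + (q ∸ p₁) ≤? n
    ... | yes short = refute m₁ m₂ mⱼ (<⇒≢ p₁<p₂) (<⇒≢ p₂<q) (<⇒≢ p₁<q)
      (middle (mkBetween (i₁ , a) (i₂ , a) (j , b) (from middle-between⇔ short) (layerBetween-start a b)))
      where p₁<q = <-trans p₁<p₂ p₂<q
            open Sorted p₁<p₂ p₂<q (toℕ<n j)
    ... | no ¬short = refute m₁ mⱼ m₃ (<⇒≢ p₁<q) (<⇒≢ q<p₃) (<⇒≢ p₁<p₃)
      (last (mkBetween (i₁ , a) (i₃ , a) (j , b) (from last-between⇔ (≰⇒≥ ¬short)) (layerBetween-start a b)))
      where p₁<q = <-trans p₁<p₂ p₂<q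
            open Sorted p₁<q q<p₃ (toℕ<n i₃)

    after : p₃ < q → ⊥
    after p₃<q with (q ∸ p₂) + (q ∸ p₂) ≤? n
    ... | yes short = refute m₂ m₃ mⱼ (<⇒≢ p₂<p₃) (<⇒≢ p₃<q) (<⇒≢ p₂<q)
      (middle (mkBetween (i₂ , a) (i₃ , a) (j , b) (from middle-between⇔ short) (layerBetween-start a b)))
      where p₂<q = <-trans p₂<p₃ p₃<q
            open Sorted p₂<p₃ p₃<q (toℕ<n j)
    ... | no ¬short = refute m₁ m₂ mⱼ (<⇒≢ p₁<p₂) (<⇒≢ p₂<q) (<⇒≢ (<-trans p₁<p₂ p₂<q))
      (first (mkBetween (i₂ , a) (i₁ , a) (j , b) (from first-between⇔ (≰⇒≥ ¬short)) (layerBetween-start a b)))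
      where p₂<q = <-trans p₂<p₃ p₃<q
            open Sorted p₁<p₂ p₂<q (toℕ<n j)

    three-plus-one : q ≢ p₁ → q ≢ p₂ → q ≢ p₃ → ⊥
    three-plus-one q≢p₁ q≢p₂ q≢p₃ with <-cmp q p₁ | <-cmp q p₂ | <-cmp q p₃
    ... | tri≈ _ q≡p₁ _ | _ | _ = q≢p₁ q≡p₁
    ... | _ | tri≈ _ q≡p₂ _ | _ = q≢p₂ q≡p₂
    ... | _ | _ | tri≈ _ q≡p₃ _ = q≢p₃ q≡p₃
    ... | tri< q<p₁ _ _ | _ | _ = before q<p₁
    ... | tri> _ _ p₁<q | tri< q<p₂ _ _ | _ = inside₁₂ p₁<q q<p₂
    ... | tri> _ _ _ | tri> _ _ p₂<q | tri< q<p₃ _ _ = inside₂₃ p₂<q q<p₃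
    ... | tri> _ _ _ | tri> _ _ _ | tri> _ _ p₃<q = after p₃<q

  three-on-a-layer : ∀ {S} {i₁ i₂ i₃ : Fin n} {a w} → NoCollinear S →
                     (i₁ , a) ∈ S → (i₂ , a) ∈ S → (i₃ , a) ∈ S → w ∈ S →
                     i₁ ≢ i₂ → i₂ ≢ i₃ → i₁ ≢ i₃ → w ≢ (i₁ , a) → w ≢ (i₂ , a) → w ≢ (i₃ , a) → ⊥
  three-on-a-layer {S} {i₁} {i₂} {i₃} {a} {j , b} nc m₁ m₂ m₃ mⱼ i₁≢i₂ i₂≢i₃ i₁≢i₃ w≢₁ w≢₂ w≢₃
    with j ≟ᶠ i₁ | j ≟ᶠ i₂ | j ≟ᶠ i₃
  ... | yes refl | _ | _ = rung-collinear nc m₂ m₁ mⱼ (i₁≢i₂ ∘ sym) w≢₁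
  ... | _ | yes refl | _ = rung-collinear nc m₁ m₂ mⱼ i₁≢i₂ w≢₂
  ... | _ | _ | yes refl = rung-collinear nc m₁ m₃ mⱼ i₁≢i₃ w≢₃
  ... | no j≢i₁ | no j≢i₂ | no j≢i₃ =
    wlog-sorted₃ <-cmpᶠ Case swap₁₂ swap₂₃ sorted i₁≢i₂ i₂≢i₃ i₁≢i₃
      m₁ m₂ m₃ (j≢i₁ ∘ toℕ-injective) (j≢i₂ ∘ toℕ-injective) (j≢i₃ ∘ toℕ-injective)
    where
      Case : Fin n → Fin n → Fin n → Set
      Case x y z = (x , a) ∈ S → (y , a) ∈ S → (z , a) ∈ S → toℕ j ≢ toℕ x → toℕ j ≢ toℕ y → toℕ j ≢ toℕ z → ⊥
      swap₁₂ : ∀ {x y z} → Case x y z → Case y x z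
      swap₁₂ c mx my mz qx qy qz = c my mx mz qy qx qz
      swap₂₃ : ∀ {x y z} → Case x y z → Case x z y
      swap₂₃ c mx my mz qx qy qz = c mx mz my qx qz qy
      sorted : ∀ {x y z} → toℕ x < toℕ y → toℕ y < toℕ z → Case x y z
      sorted x<y y<z mx my mz = ThreePlusOne.three-plus-one nc mx my mz mⱼ x<y y<z

  other-layer : ∀ {a : Fin 2} → a ≢ zero → a ≡ suc zero
  other-layer {zero}     a≢0 = ⊥-elim (a≢0 refl)
  other-layer {suc zero} _   = refl

  crowded-layer : ∀ {S a} (A B : List Vertex) → NoCollinear S →
                  (∀ {v} → v ∈ A → v ∈ S × proj₂ v ≡ a) → (∀ {v} → v ∈ B → v ∈ S × proj₂ v ≢ a) →
                  Unique A → 3 ≤ length A → 4 ≤ length A + length B → ⊥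
  crowded-layer (_ ∷ _ ∷ _ ∷ w ∷ _) _ nc inA _ ((d₁₂ ∷ d₁₃ ∷ d₁w ∷ _) ∷ (d₂₃ ∷ d₂w ∷ _) ∷ (d₃w ∷ _) ∷ _) _ _
    with inA (here refl) | inA (there (here refl)) | inA (there (there (here refl)))
       | inA (there (there (there (here refl))))
  ... | m₁ , refl | m₂ , refl | m₃ , refl | mw , _ =
    three-on-a-layer nc m₁ m₂ m₃ mw (d₁₂ ∘ cong (_, _)) (d₂₃ ∘ cong (_, _)) (d₁₃ ∘ cong (_, _))
      (d₁w ∘ sym) (d₂w ∘ sym) (d₃w ∘ sym)
  crowded-layer (_ ∷ _ ∷ _ ∷ []) (w ∷ _) nc inA inB ((d₁₂ ∷ d₁₃ ∷ []) ∷ (d₂₃ ∷ []) ∷ _) _ _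
    with inA (here refl) | inA (there (here refl)) | inA (there (there (here refl))) | inB (here refl)
  ... | m₁ , refl | m₂ , refl | m₃ , refl | mw , w∉layer =
    three-on-a-layer nc m₁ m₂ m₃ mw (d₁₂ ∘ cong (_, _)) (d₂₃ ∘ cong (_, _)) (d₁₃ ∘ cong (_, _))
      (w∉layer ∘ cong proj₂) (w∉layer ∘ cong proj₂) (w∉layer ∘ cong proj₂)
  crowded-layer (_ ∷ _ ∷ _ ∷ []) [] _ _ _ _ _ (s≤s (s≤s (s≤s ())))
  crowded-layer []            _ _ _ _ _ ()
  crowded-layer (_ ∷ [])      _ _ _ _ _ (s≤s ())
  crowded-layer (_ ∷ _ ∷ [])  _ _ _ _ _ (s≤s (s≤s ()))

  five-on-two-layers : ∀ {S} (A B : List Vertex) → NoCollinear S →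
                   (∀ {v} → v ∈ A → v ∈ S × proj₂ v ≡ zero) → (∀ {v} → v ∈ B → v ∈ S × proj₂ v ≢ zero) →
                   Unique A → Unique B → 5 ≤ length A + length B → ⊥
  five-on-two-layers A B nc inA inB uA uB 5≤A+B with 3 ≤? length A
  ... | yes 3≤A = crowded-layer A B nc inA inB uA 3≤A (≤-trans (n≤1+n 4) 5≤A+B)
  ... | no  3≰A =
    crowded-layer B A nc inB′ inA′ uB 3≤B
      (≤-trans (n≤1+n 4) (subst (5 ≤_) (+-comm (length A) (length B)) 5≤A+B))
    where
      inB′ : ∀ {v} → v ∈ B → _ × proj₂ v ≡ suc zero
      inB′ v∈ with v∈S , v∉0 ← inB v∈ = v∈S , other-layer v∉0
      inA′ : ∀ {v} → v ∈ A → _ × proj₂ v ≢ suc zero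
      inA′ v∈ with v∈S , refl ← inA v∈ = v∈S , λ ()
      3≤B : 3 ≤ length B
      3≤B = +-cancelˡ-≤ 2 3 (length B) (≤-trans 5≤A+B (+-monoˡ-≤ (length B) (≤-pred (≰⇒> 3≰A))))

  generalPosition⇒length≤4 : ∀ {S} → GeneralPosition G S → length S ≤ 4
  generalPosition⇒length≤4 {S} gp with 5 ≤? length S
  ... | no  5≰S = ≤-pred (≰⇒> 5≰S)
  ... | yes 5≤S = ⊥-elim (five-on-two-layers (filter on₀? S) (filter (∁? on₀?) S)
                    (generalPosition⇒noCollinear gp) (∈-filter⁻ on₀?) (∈-filter⁻ (∁? on₀?))
                    (Unique.filter⁺ on₀? (proj₁ gp)) (Unique.filter⁺ (∁? on₀?) (proj₁ gp))
                    (subst (5 ≤_) (sym (length-filter+∁ on₀? S)) 5≤S))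
    where
      on₀? : Decidable (λ (v : Vertex) → proj₂ v ≡ zero)
      on₀? v = proj₂ v ≟ᶠ zero

module Mobility (n : ℕ) .{{_ : NonZero n}} where
  open Prism n
  open Collinearity n

  rotation-reaches : ∀ (i j : Fin n) a → (ρ ^ (toℕ j + (n ∸ toℕ i))) (i , a) ≡ (j , a)
  rotation-reaches i j a = ρ^-reaches (toℕ j + (n ∸ toℕ i)) {i} a (begin
    (toℕ i + (toℕ j + (n ∸ toℕ i))) % n ≡⟨ cong (_% n) (x∙yz≈y∙xz (toℕ i) (toℕ j) (n ∸ toℕ i)) ⟩
    (toℕ j + (toℕ i + (n ∸ toℕ i))) % n ≡⟨ cong (λ t → (toℕ j + t) % n) (m+[n∸m]≡n (<⇒≤ (toℕ<n i))) ⟩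
    (toℕ j + n) % n                     ≡⟨ [m+n]%n≡m%n (toℕ j) n ⟩
    toℕ j % n                           ≡⟨ m<n⇒m%n≡m (toℕ<n j) ⟩
    toℕ j                               ∎)
    where open ≡-Reasoning

  mobile-by-rotation : ∀ {S tr} → GeneralPosition G S → MovePath S (map ρ S) (S ∷ tr) →
                       (∀ a → Σ (Fin n) λ i → (i , a) ∈ S) → Mobile G S
  mobile-by-rotation {S} gp round seeds = mobile-by-symmetry gp round (n + n) covered
    where
      covered : ∀ x → Σ Vertex λ y → Σ ℕ λ k → k < n + n × y ∈ S × (ρ ^ k) y ≡ x
      covered (j , a) with i , i∈ ← seeds a =
        (i , a) , toℕ j + (n ∸ toℕ i) , +-mono-<-≤ (toℕ<n j) (m∸n≤m n (toℕ i)) , i∈ , rotation-reaches i j a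

  forward-move : ∀ pre post {i j : Fin n} {a} → suc (toℕ i) ≡ toℕ j →
                 GeneralPosition G (pre ++ (i , a) ∷ post) → GeneralPosition G (pre ++ (j , a) ∷ post) →
                 LegalMove G (pre ++ (i , a) ∷ post) (pre ++ (j , a) ∷ post)
  forward-move pre post 1+i≡j =
    legalMove-replace pre post (inj₂ (inj₁ 1+i≡j , refl)) (position≢⇒≢ (λ i≡j → 1+n≢n (trans 1+i≡j (sym i≡j))))

  rung-move : ∀ pre post {i : Fin n} {a b} → a ≢ b →
              GeneralPosition G (pre ++ (i , a) ∷ post) → GeneralPosition G (pre ++ (i , b) ∷ post) →
              LegalMove G (pre ++ (i , a) ∷ post) (pre ++ (i , b) ∷ post)
  rung-move pre post a≢b = legalMove-replace pre post (inj₁ (refl , a≢b)) (a≢b ∘ cong proj₂)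

module FourRobots (n : ℕ) .{{_ : NonZero n}} (L : ℕ) (1≤L : 1 ≤ L) (3+L<n : 3 + L < n)
              (short-L : L + L < n) (long-2+L : n < (2 + L) + (2 + L)) where
  open Prism n
  open Collinearity n
  open Mobility n

  near : (k : ℕ) → {True (k ≤? 3)} → Fin n
  near k {k≤3} = fromℕ< (≤-<-trans (≤-trans (toWitness k≤3) (m≤m+n 3 L)) 3+L<n)

  far : (k : ℕ) → {True (k ≤? 3)} → Fin n
  far k {k≤3} = fromℕ< (≤-<-trans (+-monoˡ-≤ L (toWitness k≤3)) 3+L<n)

  toℕ-near : ∀ k {k≤3} → toℕ (near k {k≤3}) ≡ k
  toℕ-near k {k≤3} = toℕ-fromℕ< (≤-<-trans (≤-trans (toWitness k≤3) (m≤m+n 3 L)) 3+L<n)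

  toℕ-far : ∀ k {k≤3} → toℕ (far k {k≤3}) ≡ k + L
  toℕ-far k {k≤3} = toℕ-fromℕ< (≤-<-trans (+-monoˡ-≤ L (toWitness k≤3)) 3+L<n)

  near-next : ∀ k {p q} → suc (toℕ (near k {p})) ≡ toℕ (near (suc k) {q})
  near-next k {p} {q} = trans (cong suc (toℕ-near k {p})) (sym (toℕ-near (suc k) {q}))

  far-next : ∀ k {p q} → suc (toℕ (far k {p})) ≡ toℕ (far (suc k) {q})
  far-next k {p} {q} = trans (cong suc (toℕ-far k {p})) (sym (toℕ-far (suc k) {q}))

  private
    short-2 : Short 2
    short-2 = ≤-<-trans (+-monoʳ-≤ 3 1≤L) 3+L<n
    short-1 : Short 1
    short-1 = short-mono {1} {2} (s≤s z≤n) short-2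
    long-3+L : Long (3 + L)
    long-3+L = long-mono {2 + L} {3 + L} (n≤1+n _) long-2+L

  l₀ l₁ : Fin 2
  l₀ = zero
  l₁ = suc zero

  start finish : List Vertex
  start  = (near 0 , l₀) ∷ (near 1 , l₁) ∷ (near 2 , l₀) ∷ (far 2 , l₁) ∷ []
  finish = (near 1 , l₀) ∷ (near 2 , l₁) ∷ (near 3 , l₀) ∷ (far 3 , l₁) ∷ []

  start-rotates : map ρ start ≡ finish
  start-rotates = cong₂ _∷_ (ρ-suc (near-next 0)) (cong₂ _∷_ (ρ-suc (near-next 1))
                    (cong₂ _∷_ (ρ-suc (near-next 2)) (cong₂ _∷_ (ρ-suc (far-next 2)) refl)))

  generalPosition-start : GeneralPosition G start
  generalPosition-start = alternating⇒generalPosition (toℕ-near 0) (toℕ-near 1) (toℕ-near 2) (toℕ-far 2) (λ ())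
    z<s (s<s z<s) (s<s (s<s 1≤L)) short-1 short-1 short-L long-2+L

  generalPosition-finish : GeneralPosition G finish
  generalPosition-finish = alternating⇒generalPosition (toℕ-near 1) (toℕ-near 2) (toℕ-near 3) (toℕ-far 3) (λ ())
    (s<s z<s) (s<s (s<s z<s)) (s<s (s<s (s<s 1≤L))) short-1 short-1 short-L long-2+L

  mobile-start : ∀ {tr} → MovePath start finish (start ∷ tr) → Mobile G start
  mobile-start {tr} round =
    mobile-by-rotation generalPosition-start
      (subst (λ T → MovePath start T (start ∷ tr)) (sym start-rotates) round) seeds
    where
      seeds : ∀ a → Σ (Fin n) λ i → (i , a) ∈ start
      seeds zero       = near 0 , here refl
      seeds (suc zero) = near 1 , there (here refl)

  before-last : List Vertex
  before-last = (near 0 , l₀) ∷ (near 2 , l₁) ∷ (near 3 , l₀) ∷ (far 3 , l₁) ∷ []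

  generalPosition-before-last : GeneralPosition G before-last
  generalPosition-before-last =
    alternating⇒generalPosition (toℕ-near 0) (toℕ-near 2) (toℕ-near 3) (toℕ-far 3) (λ ())
    z<s (s<s (s<s z<s)) (s<s (s<s (s<s 1≤L))) short-2 short-1 short-L long-3+L

  last-move : LegalMove G before-last finish
  last-move = forward-move [] _ (near-next 0) generalPosition-before-last generalPosition-finish

  -- Moving the far robot first needs Short (1 + L), false for n = 2 + 2L; moving the robot at 2
  -- first needs 2 ≤ L, false for n = 5.
  module Even (2≤L : 2 ≤ L) where
    first-moved second-moved : List Vertex
    first-moved  = (near 0 , l₀) ∷ (near 1 , l₁) ∷ (near 3 , l₀) ∷ (far 2 , l₁) ∷ []
    second-moved = (near 0 , l₀) ∷ (near 2 , l₁) ∷ (near 3 , l₀) ∷ (far 2 , l₁) ∷ []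

    private
      3<2+L : 3 < 2 + L
      3<2+L = s<s (s<s 2≤L)
      short-L-1 : Short (L ∸ 1)
      short-L-1 = short-mono (m∸n≤m L 1) short-L

    round : MovePath start finish (start ∷ first-moved ∷ second-moved ∷ before-last ∷ [])
    round = step (forward-move (_ ∷ _ ∷ []) _ (near-next 2) generalPosition-start gp₁)
           (step (forward-move (_ ∷ []) _ (near-next 1) gp₁ gp₂)
           (step (forward-move (_ ∷ _ ∷ _ ∷ []) [] (far-next 2) gp₂ generalPosition-before-last)
           (step last-move done)))
      where
        gp₁ : GeneralPosition G first-moved
        gp₁ = alternating⇒generalPosition (toℕ-near 0) (toℕ-near 1) (toℕ-near 3) (toℕ-far 2) (λ ())
          z<s (s<s z<s) 3<2+L short-1 short-2 short-L-1 long-2+L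
        gp₂ : GeneralPosition G second-moved
        gp₂ = alternating⇒generalPosition (toℕ-near 0) (toℕ-near 2) (toℕ-near 3) (toℕ-far 2) (λ ())
          z<s (s<s (s<s z<s)) 3<2+L short-2 short-1 short-L-1 long-2+L

  module Odd (short-1+L : Short (1 + L)) where
    first-moved second-moved : List Vertex
    first-moved  = (near 0 , l₀) ∷ (near 1 , l₁) ∷ (near 2 , l₀) ∷ (far 3 , l₁) ∷ []
    second-moved = (near 0 , l₀) ∷ (near 1 , l₁) ∷ (near 3 , l₀) ∷ (far 3 , l₁) ∷ []

    round : MovePath start finish (start ∷ first-moved ∷ second-moved ∷ before-last ∷ [])
    round = step (forward-move (_ ∷ _ ∷ _ ∷ []) [] (far-next 2) generalPosition-start gp₁)
           (step (forward-move (_ ∷ _ ∷ []) _ (near-next 2) gp₁ gp₂)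
           (step (forward-move (_ ∷ []) _ (near-next 1) gp₂ generalPosition-before-last)
           (step last-move done)))
      where
        gp₁ : GeneralPosition G first-moved
        gp₁ = alternating⇒generalPosition (toℕ-near 0) (toℕ-near 1) (toℕ-near 2) (toℕ-far 3) (λ ())
          z<s (s<s z<s) (s<s (s<s z<s)) short-1 short-1 short-1+L long-3+L
        gp₂ : GeneralPosition G second-moved
        gp₂ = alternating⇒generalPosition (toℕ-near 0) (toℕ-near 1) (toℕ-near 3) (toℕ-far 3) (λ ())
          z<s (s<s z<s) (s<s (s<s (s<s 1≤L))) short-1 short-2 short-L long-3+L

module Triangle where
  open Prism 3
  open Mobility 3

  SomeCollinear : Vertex → Vertex → Vertex → Vertex → Set
  SomeCollinear u v w x = Collinear u v w ⊎ Collinear u v x ⊎ Collinear u w x ⊎ Collinear v w x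

  four-collinear : ∀ u v w x → u ≢ v → u ≢ w → u ≢ x → v ≢ w → v ≢ x → w ≢ x → SomeCollinear u v w x
  four-collinear = from-yes (∀-vertex? λ u → ∀-vertex? λ v → ∀-vertex? λ w → ∀-vertex? λ x →
    ¬? (u ≟ᵛ v) →-dec ¬? (u ≟ᵛ w) →-dec ¬? (u ≟ᵛ x) →-dec ¬? (v ≟ᵛ w) →-dec ¬? (v ≟ᵛ x) →-dec ¬? (w ≟ᵛ x) →-dec
    (collinear? u v w ⊎-dec collinear? u v x ⊎-dec collinear? u w x ⊎-dec collinear? v w x))

  generalPosition⇒length≤3 : ∀ {S} → GeneralPosition G S → length S ≤ 3
  generalPosition⇒length≤3 {[]}                    _ = z≤n
  generalPosition⇒length≤3 {_ ∷ []}                _ = s≤s z≤n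
  generalPosition⇒length≤3 {_ ∷ _ ∷ []}            _ = s≤s (s≤s z≤n)
  generalPosition⇒length≤3 {_ ∷ _ ∷ _ ∷ []}        _ = s≤s (s≤s (s≤s z≤n))
  generalPosition⇒length≤3 {u ∷ v ∷ w ∷ x ∷ _}
    gp@(((u≢v ∷ u≢w ∷ u≢x ∷ _) ∷ (v≢w ∷ v≢x ∷ _) ∷ (w≢x ∷ _) ∷ _) , _) =
    ⊥-elim ([ nc u∈ v∈ w∈ u≢v v≢w u≢w
           , [ nc u∈ v∈ x∈ u≢v v≢x u≢x
           , [ nc u∈ w∈ x∈ u≢w w≢x u≢x
             , nc v∈ w∈ x∈ v≢w w≢x v≢x ]′ ]′ ]′ (four-collinear u v w x u≢v u≢w u≢x v≢w v≢x w≢x))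
    where
      nc = generalPosition⇒noCollinear gp
      u∈ = here refl
      v∈ = there (here refl)
      w∈ = there (there (here refl))
      x∈ = there (there (there (here refl)))

  layer₀ crossed₁ crossed₂ layer₁ : List Vertex
  layer₀   = (zero , zero)     ∷ (suc zero , zero)     ∷ (suc (suc zero) , zero)     ∷ []
  crossed₁ = (zero , suc zero) ∷ (suc zero , zero)     ∷ (suc (suc zero) , zero)     ∷ []
  crossed₂ = (zero , suc zero) ∷ (suc zero , suc zero) ∷ (suc (suc zero) , zero)     ∷ []
  layer₁   = (zero , suc zero) ∷ (suc zero , suc zero) ∷ (suc (suc zero) , suc zero) ∷ []

  generalPosition₃ : ∀ {u v w} → u ≢ v → u ≢ w → v ≢ w → {False (collinear? u v w)} →
                     GeneralPosition G (u ∷ v ∷ w ∷ [])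
  generalPosition₃ u≢v u≢w v≢w {¬col} =
    generalPosition ((u≢v ∷ u≢w ∷ []) ∷ (v≢w ∷ []) ∷ [] ∷ []) (noCollinear₃ (toWitnessFalse ¬col))

  mobile-layer₀ : Mobile G layer₀
  mobile-layer₀ = gp₀ , _ , toMoveSeq
    (step (rung-move [] _ (λ ()) gp₀ gp₁) (step (rung-move (_ ∷ []) _ (λ ()) gp₁ gp₂)
      (step (rung-move (_ ∷ _ ∷ []) [] (λ ()) gp₂ gp₃) done))) , covered
    where
      gp₀ : GeneralPosition G layer₀
      gp₀ = generalPosition₃ (λ ()) (λ ()) (λ ())
      gp₁ : GeneralPosition G crossed₁
      gp₁ = generalPosition₃ (λ ()) (λ ()) (λ ())
      gp₂ : GeneralPosition G crossed₂
      gp₂ = generalPosition₃ (λ ()) (λ ()) (λ ())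
      gp₃ : GeneralPosition G layer₁
      gp₃ = generalPosition₃ (λ ()) (λ ()) (λ ())
      on-layer : ∀ (i : Fin 3) a → (i , a) ∈ (zero , a) ∷ (suc zero , a) ∷ (suc (suc zero) , a) ∷ []
      on-layer zero             a = here refl
      on-layer (suc zero)       a = there (here refl)
      on-layer (suc (suc zero)) a = there (there (here refl))
      covered : ∀ x → Σ (List Vertex) λ T → T ∈ layer₀ ∷ crossed₁ ∷ crossed₂ ∷ layer₁ ∷ [] × x ∈ T
      covered (i , zero)     = layer₀ , here refl , on-layer i zero
      covered (i , suc zero) = layer₁ , there (there (there (here refl))) , on-layer i (suc zero)

  mob≡3 : MobEq G 3
  mob≡3 = (layer₀ , mobile-layer₀ , refl) , λ _ (gp , _) → generalPosition⇒length≤3 gp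

module Square where
  open Prism 4
  open Mobility 4

  move-collinear : ∀ u v w x → E G u v → u ≢ w → u ≢ x → w ≢ x → v ≢ w → v ≢ x →
                   Collinear u w x ⊎ Collinear v w x
  move-collinear = from-yes (∀-vertex? λ u → ∀-vertex? λ v → ∀-vertex? λ w → ∀-vertex? λ x →
    edge? u v →-dec ¬? (u ≟ᵛ w) →-dec ¬? (u ≟ᵛ x) →-dec ¬? (w ≟ᵛ x) →-dec ¬? (v ≟ᵛ w) →-dec ¬? (v ≟ᵛ x) →-dec
    (collinear? u w x ⊎-dec collinear? v w x))

  stuck : ∀ {S S′} → GeneralPosition G S → 3 ≤ length S → ¬ LegalMove G S S′
  stuck {S} gp 3≤|S| (u , v , u∈ , e , v∉ , _ , members , gp′)
    with w₁ , w₂ , w₁∈ , w₂∈ , w₁≢w₂ , u≢w₁ , u≢w₂ ← two-others _≟ᵛ_ u (proj₁ gp) 3≤|S| =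
    [ generalPosition⇒noCollinear gp u∈ w₁∈ w₂∈ u≢w₁ w₁≢w₂ u≢w₂
    , generalPosition⇒noCollinear gp′ (proj₂ (members v) (inj₂ refl)) (stays w₁∈ u≢w₁) (stays w₂∈ u≢w₂)
        v≢w₁ w₁≢w₂ v≢w₂ ]′
      (move-collinear u v w₁ w₂ e u≢w₁ u≢w₂ w₁≢w₂ v≢w₁ v≢w₂)
    where
      v≢w₁ : v ≢ w₁
      v≢w₁ refl = v∉ w₁∈
      v≢w₂ : v ≢ w₂
      v≢w₂ refl = v∉ w₂∈
      stays : ∀ {w} → w ∈ S → u ≢ w → w ∈ _
      stays w∈ u≢w = proj₂ (members _) (inj₁ (w∈ , u≢w ∘ sym))

  mobile⇒length≤2 : ∀ {S} → Mobile G S → length S ≤ 2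
  mobile⇒length≤2 {S} (gp , _ , moves , covered) with 3 ≤? length S
  ... | no 3≰|S| = ≤-pred (≰⇒> 3≰|S|)
  ... | yes 3≤|S| = ⊥-elim (immobile moves covered)
    where
      immobile : ∀ {tr} → MoveSeq G S tr → (∀ x → Σ (List Vertex) λ T → T ∈ tr × x ∈ T) → ⊥
      immobile (move m _) _ = stuck gp 3≤|S| m
      immobile (stop _) covered =
        generalPosition⇒noCollinear gp
          (in-S (zero , zero)) (in-S (suc zero , zero)) (in-S (suc (suc zero) , zero))
          (λ ()) (λ ()) (λ ()) (middle refl)
        where
          in-S : ∀ x → x ∈ S
          in-S x with _ , here refl , x∈ ← covered x = x∈

  pair moved : List Vertex
  pair  = (zero , zero) ∷ (zero , suc zero) ∷ []
  moved = (suc zero , zero) ∷ (zero , suc zero) ∷ []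

  mob≡2 : MobEq G 2
  mob≡2 = (pair , mobile-by-rotation gp₀ round seeds , refl) , λ _ → mobile⇒length≤2
    where
      gp₀ : GeneralPosition G pair
      gp₀ = generalPosition₂ λ ()
      gp₁ : GeneralPosition G moved
      gp₁ = generalPosition₂ λ ()
      round : MovePath pair (map ρ pair) (pair ∷ moved ∷ [])
      round = step (forward-move [] _ refl gp₀ gp₁)
             (step (forward-move (_ ∷ []) [] refl gp₁ (generalPosition₂ λ ())) done)
      seeds : ∀ a → Σ (Fin 4) λ i → (i , a) ∈ pair
      seeds zero       = zero , here refl
      seeds (suc zero) = zero , there (here refl)

parity : ∀ m → Σ ℕ λ h → m ≡ h + h ⊎ m ≡ suc (h + h)
parity zero = 0 , inj₁ refl
parity (suc m) with parity m
... | h , inj₁ refl = h , inj₂ refl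
... | h , inj₂ refl = suc h , inj₁ (cong suc (sym (+-suc h h)))

double-< : ∀ c {d} h → c + c < d → (c + h) + (c + h) < d + (h + h)
double-< c {d} h c+c<d = subst (_< d + (h + h)) (sym (interchange c h c h)) (+-monoˡ-< (h + h) c+c<d)

double-> : ∀ c {d} h → d < c + c → d + (h + h) < (c + h) + (c + h)
double-> c {d} h d<c+c = subst (d + (h + h) <_) (sym (interchange c h c h)) (+-monoˡ-< (h + h) d<c+c)

mob≡4 : ∀ n → 5 ≤ n → MobEq (Cycle n □ K₂) 4
mob≡4 _ (s≤s (s≤s (s≤s (s≤s (s≤s {n = m} _))))) with parity m
... | h , inj₁ refl = (start , mobile-start round , refl) , λ _ (gp , _) → generalPosition⇒length≤4 gp
  where
    open FourRobots (5 + (h + h)) (suc h) (s≤s z≤n) (+-monoʳ-≤ 5 (m≤m+n h h))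
                (double-< 1 h (from-yes (2 <? 5))) (double-> 3 h (from-yes (5 <? 6)))
    open Odd (double-< 2 h (from-yes (4 <? 5)))
    open UpperBound (5 + (h + h))
... | h , inj₂ refl = (start , mobile-start round , refl) , λ _ (gp , _) → generalPosition⇒length≤4 gp
  where
    open FourRobots (6 + (h + h)) (2 + h) (s≤s z≤n) (+-monoʳ-≤ 6 (m≤m+n h h))
                (double-< 2 h (from-yes (4 <? 6))) (double-> 4 h (from-yes (6 <? 8)))
    open Even (s≤s (s≤s z≤n))
    open UpperBound (6 + (h + h))

theorem3p4 : (n : ℕ) → 3 ≤ n →
    (n ≡ 3 → MobEq (Cycle n □ K₂) 3) ×
    (n ≡ 4 → MobEq (Cycle n □ K₂) 2) ×
    (5 ≤ n → MobEq (Cycle n □ K₂) 4)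
theorem3p4 n _ = (λ { refl → Triangle.mob≡3 }) , (λ { refl → Square.mob≡2 }) , mob≡4 n
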